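{- Let $r$ be an indeterminate and $g(x)=\frac{1+(r-1)x}{(1-x)(1+rx)}$. Let $h(x)=\frac{1}{1+x}\,g\!\left(\frac{x}{1+x}\right)$ be its inverse binomial transform (so $h(x)=\frac{1+rx}{1+(r+1)x}$), and let $R(x,r)=\frac{1}{x}u(x)$, where $u(x)$ is the power series with $u(0)=0$ solving $u\,h(u)=x$. Then $R(x,r)=\frac{1}{1-(r+1)x}\,c\!\left(\frac{ -rx}{(1-(r+1)x)^2}\right)$, and $R$ expands to the signed Narayana triangle: $[x^0]R=1$ and, for $n\ge1$, $[x^nr^k]R=(-1)^k\frac{1}{n}\binom{n}{k+1}\binom{n}{k}$ for $0\le k\le n-1$ (and $0$ for $k\ge n$). Its first rows are $1;\ 1;\ 1,-1;\ 1,-3,1;\ 1,-6,6,-1;\ 1,-10,20,-10,1$.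
   Context: $c(x)=\frac{1-\sqrt{1-4x}}{2x}=\sum_{n\ge0}\frac{1}{n+1}\binom{2n}{n}x^n$ is the Catalan generating function. A bivariate series $\sum_{n,k}T_{n,k}x^nr^k$ is said to expand to the triangle $(T_{n,k})$. -}

module Defs where

open import Data.Nat as ℕ using (ℕ; zero; suc; _∸_; _<_; _≤_)
open import Data.Nat.Combinatorics using (_C_)
open import Data.Nat.DivMod using (_/_)
open import Data.Integer as ℤ using (ℤ; +_; -_; _+_; _*_)

-- Bivariate formal power series in x and r with integer coefficients:
-- f n k = [x^n r^k] f.
Ser : Set
Ser = ℕ → ℕ → ℤ

sumTo : ℕ → (ℕ → ℤ) → ℤ
sumTo zero    f = f zero
sumTo (suc n) f = sumTo n f + f (suc n)

_≐_ : Ser → Ser → Set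
f ≐ g = ∀ n k → f n k ≡ g n k
  where open import Relation.Binary.PropositionalEquality using (_≡_)

infix 4 _≐_

zeroS : Ser
zeroS _ _ = + 0

oneS : Ser
oneS zero zero = + 1
oneS _    _    = + 0

X : Ser
X (suc zero) zero = + 1
X _          _    = + 0

Rv : Ser
Rv zero (suc zero) = + 1
Rv _    _          = + 0

_⊕_ : Ser → Ser → Ser
(f ⊕ g) n k = f n k + g n k

⊝_ : Ser → Ser
(⊝ f) n k = - f n k

_⊛_ : Ser → Ser → Ser
(f ⊛ g) n k = sumTo n λ i → sumTo k λ j → f i j * g (n ∸ i) (k ∸ j)

infixl 7 _⊛_
infixl 6 _⊕_

_^S_ : Ser → ℕ → Ser
f ^S zero  = oneS
f ^S suc m = f ⊛ (f ^S m)

-- Inverse of 1 + f for a series f without x^0 term: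
-- 1/(1+f) = Σ_m (-f)^m; the x^n coefficient only involves m ≤ n.
inv1+ : Ser → Ser
inv1+ f n k = sumTo n λ m → ((⊝ f) ^S m) n k

-- Composition f(v) for v without x^0 term, f ∈ ℤ[r][[y]]:
-- [x^n r^k] f(v) = Σ_{m ≤ n} Σ_{j ≤ k} [y^m r^j] f · [x^n r^(k-j)] v^m.
_∘S_ : Ser → Ser → Ser
(f ∘S v) n k = sumTo n λ m → sumTo k λ j → f m j * (v ^S m) n (k ∸ j)

-- g(x) = (1+(r-1)x) / ((1-x)(1+rx)), with
-- (1-x)(1+rx) = 1 + ((r-1)x - r x^2)
gS : Ser
gS = (oneS ⊕ (Rv ⊕ ⊝ oneS) ⊛ X) ⊛ inv1+ ((Rv ⊕ ⊝ oneS) ⊛ X ⊕ ⊝ (Rv ⊛ X ⊛ X))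

invBinom : Ser → Ser
invBinom f = inv1+ X ⊛ (f ∘S (X ⊛ inv1+ X))

hS : Ser
hS = (oneS ⊕ Rv ⊛ X) ⊛ inv1+ ((Rv ⊕ oneS) ⊛ X)

catalan : ℕ → ℕ
catalan n = ((2 ℕ.* n) C n) / suc n

cS : Ser
cS n zero    = + catalan n
cS n (suc _) = + 0

sign : ℕ → ℤ → ℤ
sign zero    z = z
sign (suc k) z = - sign k z

signedNarayana : (n : ℕ) → .{{ℕ.NonZero n}} → ℕ → ℤ
signedNarayana n k = sign k (+ (((n C suc k) ℕ.* (n C k)) / n))

module Submission where

-- Then:
--  * h = 1/(1+x) · g(x/(1+x)) = (1+rx)/(1+(r+1)x) is a polynomial identity
--    modulo (1+x)·(1/(1+x)) = 1;
--  * with u = x R, the equation u h(u) = x is equivalent to the quadratic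
--    Q(R) = r x R² + (1-(r+1)x) R - 1 = 0, which has exactly one root;
--  * the closed form c(w)/(1-(r+1)x), w = -rx/(1-(r+1)x)², is a root because
--    c = 1 + x c², itself derived from the Catalan recurrence via the
--    differential equation (1-4x) s' = -2s for s = 1 - 2xc;
--  * the root also satisfies a first-order linear differential equation whose
--    unique solution is the signed Narayana series, as the four-term
--    recurrence of the Narayana numbers shows.

open import Algebra
open import Data.Nat as ℕ using (ℕ; zero; suc; _∸_; _≤_; _<_; z≤n; s≤s)
import Data.Nat.Properties as ℕP
open import Data.Product using (_,_)
import Relation.Binary.PropositionalEquality as PE
open PE using (_≡_)
import Relation.Binary.Reasoning.Setoid
open import Defs

-- Applying this twice (ℤ, then
-- ℤ[[r]]) gives the ring structure on the bivariate series 'Ser' of Defs.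
module PowerSeries {c ℓ} (CR : CommutativeRing c ℓ) where
  open CommutativeRing CR renaming (Carrier to A) hiding (zero)
  open import Relation.Binary.Reasoning.Setoid setoid
  open import Algebra.Properties.Ring ring using (-‿+-comm)
  open import Algebra.Properties.CommutativeSemigroup +-commutativeSemigroup using (interchange)

  Σ : ℕ → (ℕ → A) → A
  Σ zero    f = f zero
  Σ (suc n) f = Σ n f + f (suc n)

  Σ-cong : ∀ n {f g : ℕ → A} → (∀ i → i ≤ n → f i ≈ g i) → Σ n f ≈ Σ n g
  Σ-cong zero    h = h 0 z≤n
  Σ-cong (suc n) h = +-cong (Σ-cong n (λ i i≤n → h i (ℕP.m≤n⇒m≤1+n i≤n))) (h (suc n) ℕP.≤-refl)

  Σ-cong′ : ∀ n {f g : ℕ → A} → (∀ i → f i ≈ g i) → Σ n f ≈ Σ n g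
  Σ-cong′ n h = Σ-cong n (λ i _ → h i)

  Σ-+ : ∀ n (f g : ℕ → A) → Σ n (λ i → f i + g i) ≈ Σ n f + Σ n g
  Σ-+ zero    f g = refl
  Σ-+ (suc n) f g = trans (+-congʳ (Σ-+ n f g)) (interchange _ _ _ _)

  Σ-*ˡ : ∀ n a (f : ℕ → A) → a * Σ n f ≈ Σ n (λ i → a * f i)
  Σ-*ˡ zero    a f = refl
  Σ-*ˡ (suc n) a f = trans (distribˡ a (Σ n f) (f (suc n))) (+-congʳ (Σ-*ˡ n a f))

  Σ-*ʳ : ∀ n a (f : ℕ → A) → Σ n f * a ≈ Σ n (λ i → f i * a)
  Σ-*ʳ n a f = trans (*-comm _ a) (trans (Σ-*ˡ n a f) (Σ-cong′ n (λ i → *-comm a (f i))))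

  Σ-neg : ∀ n (f : ℕ → A) → - Σ n f ≈ Σ n (λ i → - f i)
  Σ-neg zero    f = refl
  Σ-neg (suc n) f = trans (sym (-‿+-comm _ _)) (+-congʳ (Σ-neg n f))

  Σ-head : ∀ n (f : ℕ → A) → Σ (suc n) f ≈ f 0 + Σ n (λ i → f (suc i))
  Σ-head zero    f = refl
  Σ-head (suc n) f = trans (+-congʳ (Σ-head n f)) (+-assoc _ _ _)

  Σ-rev : ∀ n (f : ℕ → A) → Σ n f ≈ Σ n (λ i → f (n ∸ i))
  Σ-rev zero    f = refl
  Σ-rev (suc n) f = begin
    Σ n f + f (suc n)                   ≈⟨ +-comm _ _ ⟩
    f (suc n) + Σ n f                   ≈⟨ +-congˡ (Σ-rev n f) ⟩
    f (suc n) + Σ n (λ i → f (n ∸ i))   ≈⟨ sym (Σ-head n (λ i → f (suc n ∸ i))) ⟩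
    Σ (suc n) (λ i → f (suc n ∸ i))     ∎

  Σ-truncate : ∀ n N (f : ℕ → A) → n ≤ N → (∀ i → n ℕ.< i → f i ≈ 0#) → Σ N f ≈ Σ n f
  Σ-truncate n N f n≤N h = begin
    Σ N f                  ≈⟨ reflexive (PE.cong (λ t → Σ t f) (PE.sym (ℕP.m∸n+n≡m n≤N))) ⟩
    Σ ((N ∸ n) ℕ.+ n) f    ≈⟨ extend (N ∸ n) ⟩
    Σ n f                  ∎
    where
    extend : ∀ m → Σ (m ℕ.+ n) f ≈ Σ n f
    extend zero    = refl
    extend (suc m) = trans (+-cong (extend m) (h _ (s≤s (ℕP.m≤n+m n m)))) (+-identityʳ _)

  Σ-triangle : ∀ n (F : ℕ → ℕ → A) →
               Σ n (λ m → Σ m (λ i → F m i)) ≈ Σ n (λ i → Σ (n ∸ i) (λ j → F (i ℕ.+ j) i))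
  Σ-triangle zero    F = refl
  Σ-triangle (suc n) F = begin
    Σ n (λ m → Σ m (λ i → F m i)) + Σ (suc n) (λ i → F (suc n) i)
      ≈⟨ +-congʳ (Σ-triangle n F) ⟩
    Σ n (λ i → Σ (n ∸ i) (λ j → F (i ℕ.+ j) i)) + (Σ n (λ i → F (suc n) i) + F (suc n) (suc n))
      ≈⟨ sym (+-assoc _ _ _) ⟩
    (Σ n (λ i → Σ (n ∸ i) (λ j → F (i ℕ.+ j) i)) + Σ n (λ i → F (suc n) i)) + F (suc n) (suc n)
      ≈⟨ +-congʳ (sym (Σ-+ n _ _)) ⟩
    Σ n (λ i → Σ (n ∸ i) (λ j → F (i ℕ.+ j) i) + F (suc n) i) + F (suc n) (suc n)
      ≈⟨ +-cong (Σ-cong n row) (reflexive (PE.cong (λ t → F t (suc n)) (PE.sym (ℕP.+-identityʳ (suc n))))) ⟩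
    Σ n (λ i → Σ (suc n ∸ i) (λ j → F (i ℕ.+ j) i)) + Σ 0 (λ j → F (suc n ℕ.+ j) (suc n))
      ≈⟨ +-congˡ (reflexive (PE.cong (λ t → Σ t (λ j → F (suc n ℕ.+ j) (suc n))) (PE.sym (ℕP.n∸n≡0 n)))) ⟩
    Σ (suc n) (λ i → Σ (suc n ∸ i) (λ j → F (i ℕ.+ j) i)) ∎
    where
    -- the new diagonal term F (n+1) i extends the i-th column by one entry
    row : ∀ i → i ≤ n → Σ (n ∸ i) (λ j → F (i ℕ.+ j) i) + F (suc n) i ≈ Σ (suc n ∸ i) (λ j → F (i ℕ.+ j) i)
    row i i≤n rewrite ℕP.+-∸-assoc 1 i≤n =
      +-congˡ (reflexive (PE.cong (λ t → F t i) (PE.sym (PE.trans (ℕP.+-suc i (n ∸ i)) (PE.cong suc (ℕP.m+[n∸m]≡n i≤n))))))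

  S : Set c
  S = ℕ → A

  _≋_ : S → S → Set ℓ
  f ≋ g = ∀ n → f n ≈ g n

  _⊞_ : S → S → S
  (f ⊞ g) n = f n + g n

  ⊟_ : S → S
  (⊟ f) n = - f n

  𝟘 : S
  𝟘 _ = 0#

  𝟙 : S
  𝟙 zero    = 1#
  𝟙 (suc _) = 0#

  _⊠_ : S → S → S
  (f ⊠ g) n = Σ n (λ i → f i * g (n ∸ i))

  ⊠-comm : ∀ f g → (f ⊠ g) ≋ (g ⊠ f)
  ⊠-comm f g n = trans (Σ-rev n _) (Σ-cong n (λ i i≤n →
    trans (*-comm _ _) (reflexive (PE.cong (λ t → g t * f (n ∸ i)) (ℕP.m∸[m∸n]≡n i≤n)))))

  ⊠-identityˡ : ∀ f → (𝟙 ⊠ f) ≋ f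
  ⊠-identityˡ f n = trans (Σ-truncate 0 n _ z≤n (λ { (suc i) _ → zeroˡ _ })) (*-identityˡ _)

  ⊠-distribˡ : ∀ f g h → (f ⊠ (g ⊞ h)) ≋ ((f ⊠ g) ⊞ (f ⊠ h))
  ⊠-distribˡ f g h n = trans (Σ-cong′ n (λ i → distribˡ _ _ _)) (Σ-+ n _ _)

  ⊠-cong : ∀ {f f' g g'} → f ≋ f' → g ≋ g' → (f ⊠ g) ≋ (f' ⊠ g')
  ⊠-cong p q n = Σ-cong′ n (λ i → *-cong (p i) (q (n ∸ i)))

  ⊠-assoc : ∀ f g h → ((f ⊠ g) ⊠ h) ≋ (f ⊠ (g ⊠ h))
  ⊠-assoc f g h n = begin
    Σ n (λ m → Σ m (λ i → f i * g (m ∸ i)) * h (n ∸ m))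
      ≈⟨ Σ-cong′ n (λ m → Σ-*ʳ m _ _) ⟩
    Σ n (λ m → Σ m (λ i → (f i * g (m ∸ i)) * h (n ∸ m)))
      ≈⟨ Σ-triangle n _ ⟩
    Σ n (λ i → Σ (n ∸ i) (λ j → (f i * g ((i ℕ.+ j) ∸ i)) * h (n ∸ (i ℕ.+ j))))
      ≈⟨ Σ-cong′ n (λ i → Σ-cong′ (n ∸ i) (λ j → trans (*-assoc _ _ _)
           (reflexive (PE.cong₂ (λ a b → f i * (g a * h b)) (ℕP.m+n∸m≡n i j) (PE.sym (ℕP.∸-+-assoc n i j)))))) ⟩
    Σ n (λ i → Σ (n ∸ i) (λ j → f i * (g j * h ((n ∸ i) ∸ j))))
      ≈⟨ Σ-cong′ n (λ i → sym (Σ-*ˡ (n ∸ i) _ _)) ⟩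
    Σ n (λ i → f i * Σ (n ∸ i) (λ j → g j * h ((n ∸ i) ∸ j))) ∎

  series-isCommutativeRing : IsCommutativeRing _≋_ _⊞_ _⊠_ ⊟_ 𝟘 𝟙
  series-isCommutativeRing = record
    { isRing = record
      { +-isAbelianGroup = record
        { isGroup = record
          { isMonoid = record
            { isSemigroup = record
              { isMagma = record
                { isEquivalence = record { refl = λ n → refl ; sym = λ p n → sym (p n) ; trans = λ p q n → trans (p n) (q n) }
                ; ∙-cong = λ p q n → +-cong (p n) (q n) }
              ; assoc = λ f g h n → +-assoc _ _ _ }
            ; identity = (λ f n → +-identityˡ _) , (λ f n → +-identityʳ _) }
          ; inverse = (λ f n → -‿inverseˡ _) , (λ f n → -‿inverseʳ _)
          ; ⁻¹-cong = λ p n → -‿cong (p n) }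
        ; comm = λ f g n → +-comm _ _ }
      ; *-cong = ⊠-cong
      ; *-assoc = ⊠-assoc
      ; *-identity = ⊠-identityˡ , (λ f n → trans (⊠-comm f 𝟙 n) (⊠-identityˡ f n))
      ; distrib = ⊠-distribˡ , (λ f g h n → trans (⊠-comm (g ⊞ h) f n)
                   (trans (⊠-distribˡ f g h n) (+-cong (⊠-comm f g n) (⊠-comm f h n)))) }
    ; *-comm = ⊠-comm }

  seriesRing : CommutativeRing c ℓ
  seriesRing = record { isCommutativeRing = series-isCommutativeRing }


module Bivariate where
  open import Data.Integer as ℤ using (ℤ; +_; -_; _+_; _*_)
  import Data.Integer.Properties as ℤP
  open import Relation.Binary.PropositionalEquality using (refl; cong; cong₂)
  open import Data.Maybe using (Maybe; just; nothing)
  import Data.Maybe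
  open import Relation.Nullary using (yes; no)
  import Algebra.Solver.Ring
  import Algebra.Solver.Ring.AlmostCommutativeRing as ACR

  module RSeries = PowerSeries ℤP.+-*-commutativeRing
  module XRSeries = PowerSeries RSeries.seriesRing

  sumTo≡Σ : ∀ n f → sumTo n f ≡ RSeries.Σ n f
  sumTo≡Σ zero    f = refl
  sumTo≡Σ (suc n) f = cong (_+ f (suc n)) (sumTo≡Σ n f)

  XRΣ-at : ∀ n (F : ℕ → RSeries.S) k → XRSeries.Σ n F k ≡ sumTo n (λ i → F i k)
  XRΣ-at zero    F k = refl
  XRΣ-at (suc n) F k = cong (_+ F (suc n) k) (XRΣ-at n F k)

  sumTo-cong : ∀ n {f g : ℕ → ℤ} → (∀ i → f i ≡ g i) → sumTo n f ≡ sumTo n g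
  sumTo-cong zero    h = h 0
  sumTo-cong (suc n) h = cong₂ _+_ (sumTo-cong n h) (h (suc n))

  ⊛≐⊠ : ∀ f g → (f ⊛ g) ≐ (f XRSeries.⊠ g)
  ⊛≐⊠ f g n k = PE.trans (sumTo-cong n (λ i → sumTo≡Σ k _)) (PE.sym (XRΣ-at n _ k))

  oneS≐𝟙 : oneS ≐ XRSeries.𝟙
  oneS≐𝟙 zero    zero    = refl
  oneS≐𝟙 zero    (suc k) = refl
  oneS≐𝟙 (suc n) k       = refl

  ≐-refl : ∀ {f} → f ≐ f
  ≐-refl n k = refl

  ≐-sym : ∀ {f g} → f ≐ g → g ≐ f
  ≐-sym p n k = PE.sym (p n k)

  ≐-trans : ∀ {f g h} → f ≐ g → g ≐ h → f ≐ h
  ≐-trans p q n k = PE.trans (p n k) (q n k)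

  ⊛-cong : ∀ {f f' g g'} → f ≐ f' → g ≐ g' → (f ⊛ g) ≐ (f' ⊛ g')
  ⊛-cong {f} {f'} {g} {g'} p q = ≐-trans (⊛≐⊠ f g) (≐-trans (XRSeries.⊠-cong p q) (≐-sym (⊛≐⊠ f' g')))

  ⊛-assoc : ∀ f g h → ((f ⊛ g) ⊛ h) ≐ (f ⊛ (g ⊛ h))
  ⊛-assoc f g h = ≐-trans (⊛≐⊠ (f ⊛ g) h) (≐-trans (XRSeries.⊠-cong {g = h} {g' = h} (⊛≐⊠ f g) (≐-refl {h}))
    (≐-trans (XRSeries.⊠-assoc f g h) (≐-trans (XRSeries.⊠-cong {f} ≐-refl (≐-sym (⊛≐⊠ g h))) (≐-sym (⊛≐⊠ f (g ⊛ h))))))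

  ⊛-comm : ∀ f g → (f ⊛ g) ≐ (g ⊛ f)
  ⊛-comm f g = ≐-trans (⊛≐⊠ f g) (≐-trans (XRSeries.⊠-comm f g) (≐-sym (⊛≐⊠ g f)))

  ⊛-identityˡ : ∀ f → (oneS ⊛ f) ≐ f
  ⊛-identityˡ f = ≐-trans (⊛≐⊠ oneS f) (≐-trans (XRSeries.⊠-cong oneS≐𝟙 (≐-refl {f})) (XRSeries.⊠-identityˡ f))

  ⊛-distribˡ : ∀ f g h → (f ⊛ (g ⊕ h)) ≐ ((f ⊛ g) ⊕ (f ⊛ h))
  ⊛-distribˡ f g h = ≐-trans (⊛≐⊠ f (g ⊕ h)) (≐-trans (XRSeries.⊠-distribˡ f g h)
     (λ n k → cong₂ _+_ (PE.sym (⊛≐⊠ f g n k)) (PE.sym (⊛≐⊠ f h n k))))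

  Ser-isCommutativeRing : IsCommutativeRing _≐_ _⊕_ _⊛_ ⊝_ zeroS oneS
  Ser-isCommutativeRing = record
    { isRing = record
      { +-isAbelianGroup = CommutativeRing.+-isAbelianGroup XRSeries.seriesRing
      ; *-cong = ⊛-cong
      ; *-assoc = ⊛-assoc
      ; *-identity = ⊛-identityˡ , (λ f → ≐-trans (⊛-comm f oneS) (⊛-identityˡ f))
      ; distrib = ⊛-distribˡ , (λ f g h → ≐-trans (⊛-comm (g ⊕ h) f)
                   (≐-trans (⊛-distribˡ f g h) (λ n k → cong₂ _+_ (⊛-comm f g n k) (⊛-comm f h n k)))) }
    ; *-comm = ⊛-comm }

  SerRing : CommutativeRing _ _
  SerRing = record { isCommutativeRing = Ser-isCommutativeRing }

  sumTo-single0 : ∀ n (f : ℕ → ℤ) → (∀ i → f (suc i) ≡ + 0) → sumTo n f ≡ f 0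
  sumTo-single0 zero    f h = refl
  sumTo-single0 (suc n) f h = PE.trans (cong₂ _+_ (sumTo-single0 n f h) (h n)) (ℤP.+-identityʳ _)

  sumTo-zero : ∀ n (f : ℕ → ℤ) → (∀ i → f i ≡ + 0) → sumTo n f ≡ + 0
  sumTo-zero n f h = PE.trans (sumTo-single0 n f (λ i → h (suc i))) (h 0)

  ι : ℤ → Ser
  ι z zero zero = z
  ι z _    _    = + 0

  ι⊛ : ∀ c f n k → (ι c ⊛ f) n k ≡ c * f n k
  ι⊛ c f n k = PE.trans (sumTo-single0 n _ (λ i → sumTo-zero k _ (λ j → refl)))
                        (sumTo-single0 k _ (λ j → refl))

  ι-* : ∀ a b → ι (a * b) ≐ (ι a ⊛ ι b)
  ι-* a b n k = PE.sym (PE.trans (ι⊛ a (ι b) n k) (times-ι n k))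
    where
    times-ι : ∀ n k → a * ι b n k ≡ ι (a * b) n k
    times-ι zero    zero    = refl
    times-ι zero    (suc k) = ℤP.*-zeroʳ a
    times-ι (suc n) k       = ℤP.*-zeroʳ a

  ι-+ : ∀ a b → ι (a + b) ≐ (ι a ⊕ ι b)
  ι-+ a b zero    zero    = refl
  ι-+ a b zero    (suc k) = refl
  ι-+ a b (suc n) k       = refl

  ι-neg : ∀ a → ι (- a) ≐ (⊝ ι a)
  ι-neg a zero    zero    = refl
  ι-neg a zero    (suc k) = refl
  ι-neg a (suc n) k       = refl

  -- 'ι' adjusted so that 0 and 1 are sent to 'zeroS' and 'oneS' on the nose,
  -- as the ring solver requires of its coefficient morphism
  scalar : ℤ → Ser
  scalar (+ 0) = zeroS
  scalar (+ 1) = oneS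
  scalar z     = ι z

  scalar≐ι : ∀ z → scalar z ≐ ι z
  scalar≐ι (+ 0) zero zero = refl
  scalar≐ι (+ 0) zero (suc k) = refl
  scalar≐ι (+ 0) (suc n) k = refl
  scalar≐ι (+ 1) zero zero = refl
  scalar≐ι (+ 1) zero (suc k) = refl
  scalar≐ι (+ 1) (suc n) k = refl
  scalar≐ι (+ suc (suc z)) = ≐-refl
  scalar≐ι (ℤ.-[1+ z ]) = ≐-refl

  two four : Ser
  two  = scalar (+ 2)
  four = scalar (+ 4)

  scalar-⊛ : ∀ c f n k → (scalar c ⊛ f) n k ≡ c * f n k
  scalar-⊛ c f n k = PE.trans (⊛-cong (scalar≐ι c) (≐-refl {f}) n k) (ι⊛ c f n k)

  scalarMorphism : ACR._-Raw-AlmostCommutative⟶_ (CommutativeRing.rawRing ℤP.+-*-commutativeRing)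
                                                   (ACR.fromCommutativeRing SerRing)
  scalarMorphism = record
    { ⟦_⟧    = scalar
    ; +-homo = λ a b → ≐-trans (scalar≐ι (a + b)) (≐-trans (ι-+ a b) (λ n k → cong₂ _+_ (PE.sym (scalar≐ι a n k)) (PE.sym (scalar≐ι b n k))))
    ; *-homo = λ a b → ≐-trans (scalar≐ι (a * b)) (≐-trans (ι-* a b) (⊛-cong (≐-sym (scalar≐ι a)) (≐-sym (scalar≐ι b))))
    ; -‿homo = λ a → ≐-trans (scalar≐ι (- a)) (≐-trans (ι-neg a) (λ n k → cong -_ (PE.sym (scalar≐ι a n k))))
    ; 0-homo = ≐-refl
    ; 1-homo = ≐-refl }

  scalar-≟ : ∀ a b → Maybe (scalar a ≐ scalar b)
  scalar-≟ a b with a ℤ.≟ b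
  ... | yes refl = just ≐-refl
  ... | no _     = nothing

  module SerSolver = Algebra.Solver.Ring (CommutativeRing.rawRing ℤP.+-*-commutativeRing)
                                         (ACR.fromCommutativeRing SerRing) scalarMorphism scalar-≟

  ⊕-l : ∀ a {b c} → b ≐ c → (a ⊕ b) ≐ (a ⊕ c)
  ⊕-l a p n k = cong (λ t → a n k + t) (p n k)

  ⊕-r : ∀ {a b} c → a ≐ b → (a ⊕ c) ≐ (b ⊕ c)
  ⊕-r c p n k = cong (λ t → t + c n k) (p n k)

  ⊕c : ∀ {a b c d} → a ≐ b → c ≐ d → (a ⊕ c) ≐ (b ⊕ d)
  ⊕c p q n k = cong₂ _+_ (p n k) (q n k)

  ⊝c : ∀ {a b} → a ≐ b → (⊝ a) ≐ (⊝ b)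
  ⊝c p n k = cong -_ (p n k)

  ⊛-l : ∀ a {b c} → b ≐ c → (a ⊛ b) ≐ (a ⊛ c)
  ⊛-l a {b} {c} p = ⊛-cong {a} {a} {b} {c} ≐-refl p

  ⊛-r : ∀ {a b} c → a ≐ b → (a ⊛ c) ≐ (b ⊛ c)
  ⊛-r {a} {b} c p = ⊛-cong {a} {b} {c} {c} p ≐-refl

  module ≐-Reasoning = Relation.Binary.Reasoning.Setoid (CommutativeRing.setoid SerRing)

module SeriesBasics where
  open import Data.Integer as ℤ using (ℤ; +_; -_; _+_; _*_)
  open import Data.Sum using (inj₂)
  import Data.Integer.Properties as ℤP
  open PE using (refl; cong; cong₂; sym; trans)
  open Bivariate
  open SerSolver using (solve; _:+_; _:*_; _:-_; _:=_; con)

  NoConst : Ser → Set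
  NoConst f = ∀ k → f 0 k ≡ + 0

  ∸-suc-< : ∀ n i → i < n → n ∸ suc i < n
  ∸-suc-< (suc n) i _ = s≤s (ℕP.m∸n≤m n i)

  sumTo-cong≤ : ∀ n {f g : ℕ → ℤ} → (∀ i → i ≤ n → f i ≡ g i) → sumTo n f ≡ sumTo n g
  sumTo-cong≤ n {f} {g} h = trans (sumTo≡Σ n f) (trans (RSeries.Σ-cong n h) (sym (sumTo≡Σ n g)))

  sumTo-head : ∀ n (f : ℕ → ℤ) → sumTo (suc n) f ≡ f 0 + sumTo n (λ i → f (suc i))
  sumTo-head n f = trans (sumTo≡Σ (suc n) f) (trans (RSeries.Σ-head n f) (cong (λ t → f 0 + t) (sym (sumTo≡Σ n _))))

  sumTo-+ : ∀ n (f g : ℕ → ℤ) → sumTo n (λ i → f i + g i) ≡ sumTo n f + sumTo n g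
  sumTo-+ n f g = trans (sumTo≡Σ n _) (trans (RSeries.Σ-+ n f g) (sym (cong₂ _+_ (sumTo≡Σ n f) (sumTo≡Σ n g))))

  sumTo-*ˡ : ∀ n a (f : ℕ → ℤ) → a * sumTo n f ≡ sumTo n (λ i → a * f i)
  sumTo-*ˡ n a f = trans (cong (a *_) (sumTo≡Σ n f)) (trans (RSeries.Σ-*ˡ n a f) (sym (sumTo≡Σ n _)))

  sumTo-neg : ∀ n (f : ℕ → ℤ) → - sumTo n f ≡ sumTo n (λ i → - f i)
  sumTo-neg n f = trans (cong -_ (sumTo≡Σ n f)) (trans (RSeries.Σ-neg n f) (sym (sumTo≡Σ n _)))

  sumTo-truncate : ∀ n N (f : ℕ → ℤ) → n ≤ N → (∀ i → n < i → f i ≡ + 0) → sumTo N f ≡ sumTo n f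
  sumTo-truncate n N f le h = trans (sumTo≡Σ N f) (trans (RSeries.Σ-truncate n N f le h) (sym (sumTo≡Σ n f)))

  sumTo-zero≤ : ∀ n (f : ℕ → ℤ) → (∀ i → i ≤ n → f i ≡ + 0) → sumTo n f ≡ + 0
  sumTo-zero≤ n f h = trans (sumTo-cong≤ n h) (sumTo-zero n (λ _ → + 0) (λ _ → refl))

  suc-cancel : ∀ n x → + suc n * x ≡ + 0 → x ≡ + 0
  suc-cancel n x p with ℤP.i*j≡0⇒i≡0∨j≡0 (+ suc n) {x} p
  ... | inj₂ x≡0 = x≡0

  X⊛-0 : ∀ f k → (X ⊛ f) 0 k ≡ + 0
  X⊛-0 f k = sumTo-zero k _ (λ j → refl)

  X⊛-suc : ∀ f n k → (X ⊛ f) (suc n) k ≡ f n k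
  X⊛-suc f n k = begin
    sumTo (suc n) F                   ≡⟨ sumTo-head n F ⟩
    F 0 + sumTo n (λ i → F (suc i))   ≡⟨ cong₂ _+_ (sumTo-zero k _ (λ j → refl))
                                                   (sumTo-single0 n _ (λ i → sumTo-zero k _ (λ j → refl))) ⟩
    + 0 + F 1                         ≡⟨ ℤP.+-identityˡ _ ⟩
    F 1                               ≡⟨ sumTo-single0 k _ (λ j → refl) ⟩
    + 1 * f n k                       ≡⟨ ℤP.*-identityˡ _ ⟩
    f n k                             ∎
    where
    open PE.≡-Reasoning
    F : ℕ → ℤ
    F i = sumTo k (λ j → X i j * f (suc n ∸ i) (k ∸ j))

  Rv⊛-0 : ∀ f n → (Rv ⊛ f) n 0 ≡ + 0
  Rv⊛-0 f n = sumTo-zero n _ (λ { zero → refl ; (suc i) → refl })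

  Rv⊛-suc : ∀ f n k → (Rv ⊛ f) n (suc k) ≡ f n k
  Rv⊛-suc f n k = begin
    sumTo n F                                            ≡⟨ sumTo-single0 n F (λ i → sumTo-zero (suc k) _ (λ j → refl)) ⟩
    F 0                                                  ≡⟨ sumTo-head k _ ⟩
    + 0 + sumTo k (λ j → Rv 0 (suc j) * f n (k ∸ j))     ≡⟨ ℤP.+-identityˡ _ ⟩
    sumTo k (λ j → Rv 0 (suc j) * f n (k ∸ j))           ≡⟨ sumTo-single0 k _ (λ j → refl) ⟩
    + 1 * f n k                                          ≡⟨ ℤP.*-identityˡ _ ⟩
    f n k                                                ∎
    where
    open PE.≡-Reasoning
    F : ℕ → ℤ
    F i = sumTo (suc k) (λ j → Rv i j * f (n ∸ i) (suc k ∸ j))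

  noConst-⊛ˡ : ∀ f g → NoConst f → NoConst (f ⊛ g)
  noConst-⊛ˡ f g z k = sumTo-zero k _ (λ j → cong (_* g 0 (k ∸ j)) (z j))

  noConst-⊛ʳ : ∀ f g → NoConst g → NoConst (f ⊛ g)
  noConst-⊛ʳ f g z k = trans (⊛-comm f g 0 k) (noConst-⊛ˡ g f z k)

  noConst-X : NoConst X
  noConst-X k = refl

  noConst-⊕ : ∀ f g → NoConst f → NoConst g → NoConst (f ⊕ g)
  noConst-⊕ f g p q k = cong₂ _+_ (p k) (q k)

  noConst-⊝ : ∀ f → NoConst f → NoConst (⊝ f)
  noConst-⊝ f p k = cong -_ (p k)

  ⊛-local : ∀ c Q Q' n → (∀ i k → i ≤ n → Q i k ≡ Q' i k) → ∀ k → (c ⊛ Q) n k ≡ (c ⊛ Q') n k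
  ⊛-local c Q Q' n h k = sumTo-cong≤ n (λ i i≤n → sumTo-cong≤ k (λ j _ →
    cong (c i j *_) (h (n ∸ i) (k ∸ j) (ℕP.m∸n≤m n i))))

  noConst-⊛-local : ∀ v Q Q' n → NoConst v → (∀ i k → i < n → Q i k ≡ Q' i k) → ∀ k → (v ⊛ Q) n k ≡ (v ⊛ Q') n k
  noConst-⊛-local v Q Q' n z h k = sumTo-cong≤ n λ
    { zero _ → sumTo-cong≤ k (λ j _ → trans (cong (_* Q n (k ∸ j)) (z j)) (sym (cong (_* Q' n (k ∸ j)) (z j))))
    ; (suc i) i<n → sumTo-cong≤ k (λ j _ → cong (v (suc i) j *_) (h (n ∸ suc i) (k ∸ j) (∸-suc-< n i i<n))) }

  ^S-cong : ∀ {f g} m → f ≐ g → (f ^S m) ≐ (g ^S m)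
  ^S-cong zero    p = ≐-refl
  ^S-cong (suc m) p = ⊛-cong p (^S-cong m p)

  pow-vanishBelow : ∀ v → NoConst v → ∀ m n k → n < m → (v ^S m) n k ≡ + 0
  pow-vanishBelow v z (suc m) n k n<m = sumTo-zero≤ n _ λ
    { zero _ → sumTo-zero k _ (λ j → cong (_* (v ^S m) n (k ∸ j)) (z j))
    ; (suc i) i<n → sumTo-zero k _ (λ j → trans (cong (v (suc i) j *_)
          (pow-vanishBelow v z m (n ∸ suc i) (k ∸ j) (ℕP.<-≤-trans (∸-suc-< n i i<n) (ℕP.≤-pred n<m))))
          (ℤP.*-zeroʳ (v (suc i) j))) }

  +zero⊛ : ∀ A D M → D ≐ zeroS → (A ⊕ D ⊛ M) ≐ A
  +zero⊛ A D M p = ≐-trans (⊕-l A (⊛-r M p)) (solve 2 (λ a m → a :+ con (+ 0) :* m := a) ≐-refl A M)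

  ΣSer : ℕ → (ℕ → Ser) → Ser
  ΣSer zero    F = F 0
  ΣSer (suc N) F = ΣSer N F ⊕ F (suc N)

  ΣSer-at : ∀ N F n k → ΣSer N F n k ≡ sumTo N (λ m → F m n k)
  ΣSer-at zero    F n k = refl
  ΣSer-at (suc N) F n k = cong (_+ F (suc N) n k) (ΣSer-at N F n k)

  ΣSer-cong : ∀ N {F G} → (∀ m → F m ≐ G m) → ΣSer N F ≐ ΣSer N G
  ΣSer-cong zero    h     = h 0
  ΣSer-cong (suc N) h n k = cong₂ _+_ (ΣSer-cong N h n k) (h (suc N) n k)

  ΣSer-*ˡ : ∀ N a F → (a ⊛ ΣSer N F) ≐ ΣSer N (λ m → a ⊛ F m)
  ΣSer-*ˡ zero    a F = ≐-refl
  ΣSer-*ˡ (suc N) a F = ≐-trans (⊛-distribˡ a (ΣSer N F) (F (suc N))) (⊕-r (a ⊛ F (suc N)) (ΣSer-*ˡ N a F))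

  geomSum : Ser → ℕ → Ser
  geomSum g N = ΣSer N (λ m → g ^S m)

  geomSum-telescope : ∀ g N → ((oneS ⊕ ⊝ g) ⊛ geomSum g N) ≐ (oneS ⊕ ⊝ (g ^S suc N))
  geomSum-telescope g zero = solve 1 (λ g → (con (+ 1) :- g) :* con (+ 1) := con (+ 1) :- g :* con (+ 1)) ≐-refl g
  geomSum-telescope g (suc N) = ≐-trans (⊛-distribˡ (oneS ⊕ ⊝ g) (geomSum g N) (g ^S suc N))
     (≐-trans (⊕-r ((oneS ⊕ ⊝ g) ⊛ (g ^S suc N)) (geomSum-telescope g N))
     (solve 2 (λ g q → (con (+ 1) :- q) :+ (con (+ 1) :- g) :* q := con (+ 1) :- g :* q) ≐-refl g (g ^S suc N)))

  inv1+≐geomSum : ∀ f → NoConst f → ∀ N i k → i ≤ N → inv1+ f i k ≡ geomSum (⊝ f) N i k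
  inv1+≐geomSum f z N i k i≤N =
    sym (trans (ΣSer-at N _ i k) (sumTo-truncate i N _ i≤N (λ m i<m → pow-vanishBelow (⊝ f) (noConst-⊝ f z) m i k i<m)))

  inv1+-inverse : ∀ f → NoConst f → ((oneS ⊕ f) ⊛ inv1+ f) ≐ oneS
  inv1+-inverse f z n k = begin
    ((oneS ⊕ f) ⊛ inv1+ f) n k           ≡⟨ ⊛-local (oneS ⊕ f) (inv1+ f) (geomSum g n) n (inv1+≐geomSum f z n) k ⟩
    ((oneS ⊕ f) ⊛ geomSum g n) n k       ≡⟨ ⊛-r (geomSum g n) (⊕-l oneS (λ a b → sym (ℤP.neg-involutive (f a b)))) n k ⟩
    ((oneS ⊕ ⊝ g) ⊛ geomSum g n) n k     ≡⟨ geomSum-telescope g n n k ⟩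
    oneS n k + - (g ^S suc n) n k        ≡⟨ cong (λ t → oneS n k + - t) (pow-vanishBelow g (noConst-⊝ f z) (suc n) n k (ℕP.n<1+n n)) ⟩
    oneS n k + - + 0                     ≡⟨ ℤP.+-identityʳ _ ⟩
    oneS n k                             ∎
    where
    open PE.≡-Reasoning
    g : Ser
    g = ⊝ f

  inv1+-cong : ∀ {f g} → f ≐ g → inv1+ f ≐ inv1+ g
  inv1+-cong p n k = sumTo-cong n (λ m → ^S-cong m (⊝c p) n k)

  inv-unique : ∀ P A B → (P ⊛ A) ≐ oneS → (P ⊛ B) ≐ oneS → A ≐ B
  inv-unique P A B pa pb = begin
    A             ≈⟨ ≐-sym (⊛-identityˡ A) ⟩
    oneS ⊛ A      ≈⟨ ⊛-r A (≐-sym pb) ⟩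
    (P ⊛ B) ⊛ A   ≈⟨ solve 3 (λ P A B → (P :* B) :* A := (P :* A) :* B) ≐-refl P A B ⟩
    (P ⊛ A) ⊛ B   ≈⟨ ⊛-r B pa ⟩
    oneS ⊛ B      ≈⟨ ⊛-identityˡ B ⟩
    B             ∎
    where open ≐-Reasoning

  cancel-1+ : ∀ G A → NoConst G → ((oneS ⊕ G) ⊛ A) ≐ zeroS → A ≐ zeroS
  cancel-1+ G A z h = begin
    A                              ≈⟨ ≐-sym (⊛-identityˡ A) ⟩
    oneS ⊛ A                       ≈⟨ ⊛-r A (≐-sym (inv1+-inverse G z)) ⟩
    ((oneS ⊕ G) ⊛ inv1+ G) ⊛ A     ≈⟨ solve 3 (λ P I A → (P :* I) :* A := I :* (P :* A)) ≐-refl (oneS ⊕ G) (inv1+ G) A ⟩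
    inv1+ G ⊛ ((oneS ⊕ G) ⊛ A)     ≈⟨ ⊛-l (inv1+ G) h ⟩
    inv1+ G ⊛ zeroS                ≈⟨ solve 1 (λ I → I :* con (+ 0) := con (+ 0)) ≐-refl (inv1+ G) ⟩
    zeroS                          ∎
    where open ≐-Reasoning

  X-cancel : ∀ A B → (X ⊛ A) ≐ (X ⊛ B) → A ≐ B
  X-cancel A B h n k = trans (sym (X⊛-suc A n k)) (trans (h (suc n) k) (X⊛-suc B n k))

  tailX : Ser → Ser
  tailX f n k = f (suc n) k

  noConst⇒X⊛tail : ∀ u → NoConst u → u ≐ (X ⊛ tailX u)
  noConst⇒X⊛tail u z zero    k = trans (z k) (sym (X⊛-0 (tailX u) k))
  noConst⇒X⊛tail u z (suc n) k = sym (X⊛-suc (tailX u) n k)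


-- The key
-- structural fact is the decomposition f(v) = f(0) + v · (tail f)(v); from it
-- we derive that composition with v is a ring homomorphism (additive,
-- multiplicative, fixing constants and sending x to v), by strong induction
-- on the row index, and hence commutes with taking inverses 1/(1+f).
module Composition where
  open import Data.Integer as ℤ using (ℤ; +_; _+_; _*_)
  import Data.Integer.Properties as ℤP
  open PE using (refl; cong; cong₂; sym; trans)
  open Bivariate
  open SeriesBasics
  open SerSolver using (solve; _:+_; _:*_; _:-_; _:=_; con)

  rowSeries : (ℕ → ℤ) → Ser
  rowSeries c zero    k = c k
  rowSeries c (suc n) k = + 0

  constTerm : Ser → Ser
  constTerm f = rowSeries (f 0)

  rowSeries-⊛ : ∀ c w n k → (rowSeries c ⊛ w) n k ≡ sumTo k (λ j → c j * w n (k ∸ j))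
  rowSeries-⊛ c w n k = sumTo-single0 n _ (λ i → sumTo-zero k _ (λ j → refl))

  rowSeries-⊛-one : ∀ c → (rowSeries c ⊛ oneS) ≐ rowSeries c
  rowSeries-⊛-one c = ≐-trans (⊛-comm (rowSeries c) oneS) (⊛-identityˡ (rowSeries c))

  compUpTo : Ser → Ser → ℕ → Ser
  compUpTo f v N = ΣSer N (λ m → rowSeries (f m) ⊛ (v ^S m))

  ∘-compUpTo : ∀ f v n k → (f ∘S v) n k ≡ compUpTo f v n n k
  ∘-compUpTo f v n k = sym (trans (ΣSer-at n _ n k) (sumTo-cong n (λ m → rowSeries-⊛ (f m) (v ^S m) n k)))

  compUpTo-truncate : ∀ f v → NoConst v → ∀ N i k → i ≤ N → compUpTo f v N i k ≡ compUpTo f v i i k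
  compUpTo-truncate f v z N i k i≤N = trans (ΣSer-at N _ i k) (trans (sumTo-truncate i N _ i≤N vanish) (sym (ΣSer-at i _ i k)))
    where
    vanish : ∀ m → i < m → (rowSeries (f m) ⊛ (v ^S m)) i k ≡ + 0
    vanish m i<m = trans (rowSeries-⊛ (f m) (v ^S m) i k)
      (sumTo-zero k _ (λ j → trans (cong (f m j *_) (pow-vanishBelow v z m i (k ∸ j) i<m)) (ℤP.*-zeroʳ (f m j))))

  ∘-compUpTo≥ : ∀ f v → NoConst v → ∀ N n k → n ≤ N → (f ∘S v) n k ≡ compUpTo f v N n k
  ∘-compUpTo≥ f v z N n k le = trans (∘-compUpTo f v n k) (sym (compUpTo-truncate f v z N n k le))

  ΣSer-head : ∀ N G → ΣSer (suc N) G ≐ (G 0 ⊕ ΣSer N (λ m → G (suc m)))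
  ΣSer-head N G n k = trans (ΣSer-at (suc N) G n k) (trans (sumTo-head N _) (cong (λ t → G 0 n k + t) (sym (ΣSer-at N _ n k))))

  compUpTo-suc : ∀ f v N → compUpTo f v (suc N) ≐ (constTerm f ⊕ v ⊛ compUpTo (tailX f) v N)
  compUpTo-suc f v N = begin
    compUpTo f v (suc N)
      ≈⟨ ΣSer-head N _ ⟩
    (rowSeries (f 0) ⊛ oneS) ⊕ ΣSer N (λ m → rowSeries (f (suc m)) ⊛ (v ⊛ (v ^S m)))
      ≈⟨ ⊕c (rowSeries-⊛-one (f 0)) (ΣSer-cong N (λ m → solve 3 (λ c v p → c :* (v :* p) := v :* (c :* p)) ≐-refl (rowSeries (f (suc m))) v (v ^S m))) ⟩
    constTerm f ⊕ ΣSer N (λ m → v ⊛ (rowSeries (f (suc m)) ⊛ (v ^S m)))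
      ≈⟨ ⊕-l (constTerm f) (≐-sym (ΣSer-*ˡ N v (λ m → rowSeries (f (suc m)) ⊛ (v ^S m)))) ⟩
    constTerm f ⊕ v ⊛ compUpTo (tailX f) v N ∎
    where open ≐-Reasoning

  ∘-decompose : ∀ f v → NoConst v → (f ∘S v) ≐ (constTerm f ⊕ v ⊛ (tailX f ∘S v))
  ∘-decompose f v z zero k = begin
    (f ∘S v) 0 k                              ≡⟨ ∘-compUpTo f v 0 k ⟩
    (rowSeries (f 0) ⊛ oneS) 0 k              ≡⟨ rowSeries-⊛-one (f 0) 0 k ⟩
    f 0 k                                     ≡⟨ sym (ℤP.+-identityʳ _) ⟩
    f 0 k + + 0                               ≡⟨ cong (λ t → f 0 k + t) (sym (noConst-⊛ˡ v (tailX f ∘S v) z k)) ⟩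
    (constTerm f ⊕ v ⊛ (tailX f ∘S v)) 0 k    ∎
    where open PE.≡-Reasoning
  ∘-decompose f v z (suc n) k = begin
    (f ∘S v) (suc n) k                                                ≡⟨ ∘-compUpTo f v (suc n) k ⟩
    compUpTo f v (suc n) (suc n) k                                    ≡⟨ compUpTo-suc f v n (suc n) k ⟩
    constTerm f (suc n) k + (v ⊛ compUpTo (tailX f) v n) (suc n) k    ≡⟨ cong (λ t → constTerm f (suc n) k + t)
                                                                           (noConst-⊛-local v _ _ (suc n) z low k) ⟩
    (constTerm f ⊕ v ⊛ (tailX f ∘S v)) (suc n) k                      ∎
    where
    open PE.≡-Reasoning
    low : ∀ i k' → i < suc n → compUpTo (tailX f) v n i k' ≡ (tailX f ∘S v) i k'
    low i k' i<n = sym (∘-compUpTo≥ (tailX f) v z n i k' (ℕP.≤-pred i<n))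

  ∘-congˡ : ∀ {f g} v → f ≐ g → (f ∘S v) ≐ (g ∘S v)
  ∘-congˡ v p n k = sumTo-cong n (λ m → sumTo-cong k (λ j → cong (_* (v ^S m) n (k ∸ j)) (p m j)))

  ∘-⊕ : ∀ f g v → ((f ⊕ g) ∘S v) ≐ ((f ∘S v) ⊕ (g ∘S v))
  ∘-⊕ f g v n k = trans (sumTo-cong n (λ m → trans (sumTo-cong k (λ j → ℤP.*-distribʳ-+ _ (f m j) (g m j)))
     (sumTo-+ k _ _))) (sumTo-+ n _ _)

  ∘-⊝ : ∀ f v → ((⊝ f) ∘S v) ≐ (⊝ (f ∘S v))
  ∘-⊝ f v n k = trans (sumTo-cong n (λ m → trans (sumTo-cong k (λ j → sym (ℤP.neg-distribˡ-* (f m j) _)))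
     (sym (sumTo-neg k _)))) (sym (sumTo-neg n _))

  ∘-zero : ∀ v → (zeroS ∘S v) ≐ zeroS
  ∘-zero v n k = sumTo-zero n _ (λ m → sumTo-zero k _ (λ j → refl))

  constTerm-∘ : ∀ f v → NoConst v → (constTerm f ∘S v) ≐ constTerm f
  constTerm-∘ f v z = begin
    constTerm f ∘S v                                            ≈⟨ ∘-decompose (constTerm f) v z ⟩
    constTerm (constTerm f) ⊕ v ⊛ (tailX (constTerm f) ∘S v)   ≈⟨ ⊕-l (constTerm f) (⊛-l v (∘-zero v)) ⟩
    constTerm f ⊕ v ⊛ zeroS                                     ≈⟨ solve 2 (λ c v → c :+ v :* con (+ 0) := c) ≐-refl (constTerm f) v ⟩
    constTerm f                                                 ∎
    where open ≐-Reasoning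

  const-∘ : ∀ f v → NoConst v → (∀ n k → f (suc n) k ≡ + 0) → (f ∘S v) ≐ f
  const-∘ f v z h = ≐-trans (∘-congˡ v f≐f0) (≐-trans (constTerm-∘ f v z) (≐-sym f≐f0))
    where
    f≐f0 : f ≐ constTerm f
    f≐f0 zero    k = refl
    f≐f0 (suc n) k = h n k

  one-∘ : ∀ v → NoConst v → (oneS ∘S v) ≐ oneS
  one-∘ v z = const-∘ oneS v z (λ n k → refl)

  Rv-∘ : ∀ v → NoConst v → (Rv ∘S v) ≐ Rv
  Rv-∘ v z = const-∘ Rv v z (λ n k → refl)

  X-∘ : ∀ v → NoConst v → (X ∘S v) ≐ v
  X-∘ v z = begin
    X ∘S v                            ≈⟨ ∘-decompose X v z ⟩
    constTerm X ⊕ v ⊛ (tailX X ∘S v)  ≈⟨ ⊕c X0≐0 (⊛-l v (≐-trans (∘-congˡ v tailX≐1) (one-∘ v z))) ⟩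
    zeroS ⊕ v ⊛ oneS                  ≈⟨ solve 1 (λ v → con (+ 0) :+ v :* con (+ 1) := v) ≐-refl v ⟩
    v                                 ∎
    where
    open ≐-Reasoning
    X0≐0 : constTerm X ≐ zeroS
    X0≐0 zero    k = refl
    X0≐0 (suc n) k = refl
    tailX≐1 : tailX X ≐ oneS
    tailX≐1 zero    zero    = refl
    tailX≐1 zero    (suc k) = refl
    tailX≐1 (suc n) k       = refl

  const+X⊛tail : ∀ f → f ≐ (constTerm f ⊕ X ⊛ tailX f)
  const+X⊛tail f zero    k = sym (trans (cong (λ t → f 0 k + t) (X⊛-0 (tailX f) k)) (ℤP.+-identityʳ _))
  const+X⊛tail f (suc n) k = sym (trans (ℤP.+-identityˡ _) (X⊛-suc (tailX f) n k))

  constTerm-⊛ : ∀ f g → constTerm (f ⊛ g) ≐ (constTerm f ⊛ constTerm g)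
  constTerm-⊛ f g zero    k = refl
  constTerm-⊛ f g (suc n) k = sym (sumTo-zero (suc n) _ λ
    { zero    → sumTo-zero k _ (λ j → ℤP.*-zeroʳ (f 0 j))
    ; (suc i) → sumTo-zero k _ (λ j → refl) })

  tailX-⊛ : ∀ f g → tailX (f ⊛ g) ≐ ((tailX f ⊛ g) ⊕ (constTerm f ⊛ tailX g))
  tailX-⊛ f g = X-cancel _ _ (begin
    X ⊛ tailX (f ⊛ g)
      ≈⟨ solve 2 (λ a b → b := (a :+ b) :- a) ≐-refl (constTerm (f ⊛ g)) (X ⊛ tailX (f ⊛ g)) ⟩
    (constTerm (f ⊛ g) ⊕ X ⊛ tailX (f ⊛ g)) ⊕ ⊝ constTerm (f ⊛ g)
      ≈⟨ ⊕c (≐-sym (const+X⊛tail (f ⊛ g))) (⊝c (constTerm-⊛ f g)) ⟩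
    (f ⊛ g) ⊕ ⊝ (constTerm f ⊛ constTerm g)
      ≈⟨ ⊕-r (⊝ (constTerm f ⊛ constTerm g)) (⊛-cong (const+X⊛tail f) (const+X⊛tail g)) ⟩
    ((f₀ ⊕ X ⊛ tailX f) ⊛ (g₀ ⊕ X ⊛ tailX g)) ⊕ ⊝ (f₀ ⊛ g₀)
      ≈⟨ solve 5 (λ cf cg x sf sg → ((cf :+ x :* sf) :* (cg :+ x :* sg)) :- cf :* cg := x :* ((sf :* (cg :+ x :* sg)) :+ cf :* sg))
                 ≐-refl f₀ g₀ X (tailX f) (tailX g) ⟩
    X ⊛ ((tailX f ⊛ (g₀ ⊕ X ⊛ tailX g)) ⊕ f₀ ⊛ tailX g)
      ≈⟨ ⊛-l X (⊕-r (f₀ ⊛ tailX g) (⊛-l (tailX f) (≐-sym (const+X⊛tail g)))) ⟩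
    X ⊛ ((tailX f ⊛ g) ⊕ (f₀ ⊛ tailX g)) ∎)
    where
    open ≐-Reasoning
    f₀ g₀ : Ser
    f₀ = constTerm f
    g₀ = constTerm g

  module _ (v : Ser) (z : NoConst v) where
    MulAt : Ser → Ser → ℕ → ℕ → Set
    MulAt f g n k = ((f ⊛ g) ∘S v) n k ≡ ((f ∘S v) ⊛ (g ∘S v)) n k

    mulExpand : ∀ f g F' G' → F' ≐ (tailX f ∘S v) → G' ≐ (tailX g ∘S v) →
          ((constTerm f ⊛ constTerm g) ⊕ v ⊛ ((F' ⊛ (g ∘S v)) ⊕ (constTerm f ⊛ G'))) ≐ ((f ∘S v) ⊛ (g ∘S v))
    mulExpand f g F' G' eF eG = begin
      (f₀ ⊛ g₀) ⊕ v ⊛ ((F' ⊛ (g ∘S v)) ⊕ (f₀ ⊛ G'))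
        ≈⟨ ⊕-l (f₀ ⊛ g₀) (⊛-l v (⊕-r (f₀ ⊛ G') (⊛-l F' (≐-trans (∘-decompose g v z) (⊕-l g₀ (⊛-l v (≐-sym eG))))))) ⟩
      (f₀ ⊛ g₀) ⊕ v ⊛ ((F' ⊛ (g₀ ⊕ v ⊛ G')) ⊕ (f₀ ⊛ G'))
        ≈⟨ solve 5 (λ cf cg v f' g' → (cf :* cg) :+ v :* ((f' :* (cg :+ v :* g')) :+ cf :* g') := (cf :+ v :* f') :* (cg :+ v :* g'))
                   ≐-refl f₀ g₀ v F' G' ⟩
      (f₀ ⊕ v ⊛ F') ⊛ (g₀ ⊕ v ⊛ G')
        ≈⟨ ⊛-cong (≐-trans (⊕-l f₀ (⊛-l v eF)) (≐-sym (∘-decompose f v z)))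
                  (≐-trans (⊕-l g₀ (⊛-l v eG)) (≐-sym (∘-decompose g v z))) ⟩
      (f ∘S v) ⊛ (g ∘S v) ∎
      where
      open ≐-Reasoning
      f₀ g₀ : Ser
      f₀ = constTerm f
      g₀ = constTerm g

    -- row n follows from all rows below n, for all pairs f, g at once
    mulStep : ∀ n → (∀ f g i k → i < n → MulAt f g i k) → ∀ f g k → MulAt f g n k
    mulStep n ih f g k = begin
      ((f ⊛ g) ∘S v) n k                                  ≡⟨ ∘-decompose (f ⊛ g) v z n k ⟩
      (constTerm (f ⊛ g) ⊕ v ⊛ (tailX (f ⊛ g) ∘S v)) n k  ≡⟨ cong₂ _+_ (constTerm-⊛ f g n k) (noConst-⊛-local v _ Q n z tail-ih k) ⟩
      ((constTerm f ⊛ constTerm g) ⊕ v ⊛ Q) n k           ≡⟨ mulExpand f g F' G' ≐-refl ≐-refl n k ⟩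
      ((f ∘S v) ⊛ (g ∘S v)) n k                           ∎
      where
      open PE.≡-Reasoning
      F' G' Q : Ser
      F' = tailX f ∘S v
      G' = tailX g ∘S v
      Q = (F' ⊛ (g ∘S v)) ⊕ (constTerm f ⊛ G')
      tail-ih : ∀ i k' → i < n → (tailX (f ⊛ g) ∘S v) i k' ≡ Q i k'
      tail-ih i k' i<n = begin
        (tailX (f ⊛ g) ∘S v) i k'                                          ≡⟨ ∘-congˡ v (tailX-⊛ f g) i k' ⟩
        (((tailX f ⊛ g) ⊕ (constTerm f ⊛ tailX g)) ∘S v) i k'              ≡⟨ ∘-⊕ (tailX f ⊛ g) (constTerm f ⊛ tailX g) v i k' ⟩
        ((tailX f ⊛ g) ∘S v) i k' + ((constTerm f ⊛ tailX g) ∘S v) i k'    ≡⟨ cong₂ _+_ (ih (tailX f) g i k' i<n) (ih (constTerm f) (tailX g) i k' i<n) ⟩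
        (F' ⊛ (g ∘S v)) i k' + ((constTerm f ∘S v) ⊛ G') i k'              ≡⟨ cong (λ t → (F' ⊛ (g ∘S v)) i k' + t) (⊛-r G' (constTerm-∘ f v z) i k') ⟩
        Q i k'                                                              ∎

    mulBelow : ∀ N f g n k → n < N → MulAt f g n k
    mulBelow (suc N) f g n k n<N = mulStep n (λ f' g' i k' i<n → mulBelow N f' g' i k' (ℕP.<-≤-trans i<n (ℕP.≤-pred n<N))) f g k

    ∘-⊛ : ∀ f g → ((f ⊛ g) ∘S v) ≐ ((f ∘S v) ⊛ (g ∘S v))
    ∘-⊛ f g n k = mulBelow (suc n) f g n k (ℕP.n<1+n n)

  noConst-∘ : ∀ f v → NoConst v → NoConst f → NoConst (f ∘S v)
  noConst-∘ f v z zf k = trans (∘-decompose f v z 0 k) (cong₂ _+_ (zf k) (noConst-⊛ˡ v (tailX f ∘S v) z k))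

  inv-∘ : ∀ f v → NoConst v → NoConst f → (inv1+ f ∘S v) ≐ inv1+ (f ∘S v)
  inv-∘ f v z zf = inv-unique (oneS ⊕ (f ∘S v)) _ _ inverse (inv1+-inverse (f ∘S v) (noConst-∘ f v z zf))
    where
    inverse : ((oneS ⊕ (f ∘S v)) ⊛ (inv1+ f ∘S v)) ≐ oneS
    inverse = begin
      (oneS ⊕ (f ∘S v)) ⊛ (inv1+ f ∘S v)          ≈⟨ ⊛-r (inv1+ f ∘S v) (⊕-r (f ∘S v) (≐-sym (one-∘ v z))) ⟩
      ((oneS ∘S v) ⊕ (f ∘S v)) ⊛ (inv1+ f ∘S v)   ≈⟨ ⊛-r (inv1+ f ∘S v) (≐-sym (∘-⊕ oneS f v)) ⟩
      ((oneS ⊕ f) ∘S v) ⊛ (inv1+ f ∘S v)          ≈⟨ ≐-sym (∘-⊛ v z (oneS ⊕ f) (inv1+ f)) ⟩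
      ((oneS ⊕ f) ⊛ inv1+ f) ∘S v                 ≈⟨ ∘-congˡ v (inv1+-inverse f zf) ⟩
      oneS ∘S v                                   ≈⟨ one-∘ v z ⟩
      oneS                                        ∎
      where open ≐-Reasoning


-- With I = 1/(1+x) and y = x I we have g(y) = P(y)/(1+E(y)) by the
-- homomorphism properties of composition, so I·g(y) = I P(y)/(1+E(y)).
-- The remaining identities are polynomial in x, r and I, modulo the single
-- relation (1+x) I = 1; each is written as "target + D·M" with D = (1+x) I - 1.
module InverseBinomial where
  open import Data.Integer as ℤ using (+_)
  open Bivariate
  open SeriesBasics
  open Composition
  open SerSolver using (solve; _:+_; _:*_; _:-_; _:=_; con)

  r1x : Ser
  r1x = (Rv ⊕ oneS) ⊛ X

  hNum : Ser
  hNum = oneS ⊕ Rv ⊛ X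

  noConst-r1x : NoConst r1x
  noConst-r1x = noConst-⊛ʳ (Rv ⊕ oneS) X noConst-X

  I y : Ser
  I = inv1+ X
  y = X ⊛ I

  noConst-y : NoConst y
  noConst-y = noConst-⊛ˡ X I noConst-X

  rMinus1 P E : Ser
  rMinus1 = Rv ⊕ ⊝ oneS
  P = oneS ⊕ rMinus1 ⊛ X
  E = rMinus1 ⊛ X ⊕ ⊝ (Rv ⊛ X ⊛ X)

  P′ E′ : Ser
  P′ = oneS ⊕ rMinus1 ⊛ y
  E′ = rMinus1 ⊛ y ⊕ ⊝ (Rv ⊛ y ⊛ y)

  noConst-E : NoConst E
  noConst-E = noConst-⊕ (rMinus1 ⊛ X) (⊝ (Rv ⊛ X ⊛ X)) (noConst-⊛ʳ rMinus1 X noConst-X)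
                        (noConst-⊝ (Rv ⊛ X ⊛ X) (noConst-⊛ʳ (Rv ⊛ X) X noConst-X))

  noConst-E′ : NoConst E′
  noConst-E′ = noConst-⊕ (rMinus1 ⊛ y) (⊝ (Rv ⊛ y ⊛ y)) (noConst-⊛ʳ rMinus1 y noConst-y)
                         (noConst-⊝ (Rv ⊛ y ⊛ y) (noConst-⊛ʳ (Rv ⊛ y) y noConst-y))

  rMinus1-∘ : (rMinus1 ∘S y) ≐ rMinus1
  rMinus1-∘ = ≐-trans (∘-⊕ Rv (⊝ oneS) y) (⊕c (Rv-∘ y noConst-y) (≐-trans (∘-⊝ oneS y) (⊝c (one-∘ y noConst-y))))

  P-∘ : (P ∘S y) ≐ P′
  P-∘ = ≐-trans (∘-⊕ oneS (rMinus1 ⊛ X) y) (⊕c (one-∘ y noConst-y)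
          (≐-trans (∘-⊛ y noConst-y rMinus1 X) (⊛-cong rMinus1-∘ (X-∘ y noConst-y))))

  E-∘ : (E ∘S y) ≐ E′
  E-∘ = ≐-trans (∘-⊕ (rMinus1 ⊛ X) (⊝ (Rv ⊛ X ⊛ X)) y)
          (⊕c (≐-trans (∘-⊛ y noConst-y rMinus1 X) (⊛-cong rMinus1-∘ (X-∘ y noConst-y)))
              (≐-trans (∘-⊝ (Rv ⊛ X ⊛ X) y) (⊝c (≐-trans (∘-⊛ y noConst-y (Rv ⊛ X) X)
                 (⊛-cong (≐-trans (∘-⊛ y noConst-y Rv X) (⊛-cong (Rv-∘ y noConst-y) (X-∘ y noConst-y))) (X-∘ y noConst-y))))))

  g-∘ : (gS ∘S y) ≐ (P′ ⊛ inv1+ E′)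
  g-∘ = ≐-trans (∘-⊛ y noConst-y P (inv1+ E)) (⊛-cong P-∘ (≐-trans (inv-∘ E y noConst-y noConst-E) (inv1+-cong E-∘)))

  hCand D : Ser
  hCand = I ⊛ (P′ ⊛ inv1+ E′)
  D = (oneS ⊕ X) ⊛ I ⊕ ⊝ oneS

  M₁ M₂ : Ser
  M₁ = rMinus1 ⊛ X ⊛ (oneS ⊕ X) ⊕ ⊝ (Rv ⊛ X ⊛ X ⊛ ((oneS ⊕ X) ⊛ I ⊕ oneS))
  M₂ = (oneS ⊕ X) ⊕ rMinus1 ⊛ X ⊛ ((oneS ⊕ X) ⊛ I ⊕ oneS)

  D≐0 : D ≐ zeroS
  D≐0 = ≐-trans (⊕-r (⊝ oneS) (inv1+-inverse X noConst-X)) (solve 0 (con (+ 1) :- con (+ 1) := con (+ 0)) ≐-refl)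

  expand-1+E′ : ((oneS ⊕ X) ⊛ (oneS ⊕ X) ⊛ (oneS ⊕ E′))
              ≐ ((oneS ⊕ r1x) ⊕ D ⊛ M₁)
  expand-1+E′ = solve 3 (λ x i r →
     (con (+ 1) :+ x) :* (con (+ 1) :+ x) :* (con (+ 1) :+ ((r :- con (+ 1)) :* (x :* i) :- r :* (x :* i) :* (x :* i)))
     := (con (+ 1) :+ (r :+ con (+ 1)) :* x) :+ ((con (+ 1) :+ x) :* i :- con (+ 1)) :*
          ((r :- con (+ 1)) :* x :* (con (+ 1) :+ x) :- r :* x :* x :* ((con (+ 1) :+ x) :* i :+ con (+ 1))))
     ≐-refl X I Rv

  expand-P′ : ((oneS ⊕ X) ⊛ (oneS ⊕ X) ⊛ I ⊛ P′)
            ≐ (hNum ⊕ D ⊛ M₂)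
  expand-P′ = solve 3 (λ x i r →
     (con (+ 1) :+ x) :* (con (+ 1) :+ x) :* i :* (con (+ 1) :+ (r :- con (+ 1)) :* (x :* i))
     := (con (+ 1) :+ r :* x) :+ ((con (+ 1) :+ x) :* i :- con (+ 1)) :*
          ((con (+ 1) :+ x) :+ (r :- con (+ 1)) :* x :* ((con (+ 1) :+ x) :* i :+ con (+ 1))))
     ≐-refl X I Rv

  hCand⊛[1+r1x] : (hCand ⊛ (oneS ⊕ r1x)) ≐ hNum
  hCand⊛[1+r1x] = begin
    hCand ⊛ (oneS ⊕ r1x)
      ≈⟨ ⊛-l hCand (≐-sym (≐-trans expand-1+E′ (+zero⊛ (oneS ⊕ r1x) D M₁ D≐0))) ⟩
    hCand ⊛ ((oneS ⊕ X) ⊛ (oneS ⊕ X) ⊛ (oneS ⊕ E′))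
      ≈⟨ solve 5 (λ a i p j e → (i :* (p :* j)) :* (a :* a :* (con (+ 1) :+ e)) := (a :* a :* i :* p) :* ((con (+ 1) :+ e) :* j))
                 ≐-refl (oneS ⊕ X) I P′ (inv1+ E′) E′ ⟩
    ((oneS ⊕ X) ⊛ (oneS ⊕ X) ⊛ I ⊛ P′) ⊛ ((oneS ⊕ E′) ⊛ inv1+ E′)
      ≈⟨ ⊛-cong (≐-trans expand-P′ (+zero⊛ hNum D M₂ D≐0)) (inv1+-inverse E′ noConst-E′) ⟩
    hNum ⊛ oneS
      ≈⟨ solve 1 (λ h → h :* con (+ 1) := h) ≐-refl hNum ⟩
    hNum ∎
    where open ≐-Reasoning

  invBinom-g≐h : invBinom gS ≐ hS
  invBinom-g≐h = begin
    I ⊛ (gS ∘S y)                          ≈⟨ ⊛-l I g-∘ ⟩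
    hCand                                  ≈⟨ solve 1 (λ t → t := t :* con (+ 1)) ≐-refl hCand ⟩
    hCand ⊛ oneS                           ≈⟨ ⊛-l hCand (≐-sym (inv1+-inverse r1x noConst-r1x)) ⟩
    hCand ⊛ ((oneS ⊕ r1x) ⊛ inv1+ r1x)     ≈⟨ solve 3 (λ t a k → t :* (a :* k) := (t :* a) :* k) ≐-refl hCand (oneS ⊕ r1x) (inv1+ r1x) ⟩
    (hCand ⊛ (oneS ⊕ r1x)) ⊛ inv1+ r1x     ≈⟨ ⊛-r (inv1+ r1x) hCand⊛[1+r1x] ⟩
    hNum ⊛ inv1+ r1x                       ∎
    where open ≐-Reasoning


-- It
-- is used to turn the algebraic equations of the Catalan and Narayana series
-- into first-order linear differential equations, whose solutions are
-- determined row by row.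
module Derivative where
  open import Data.Integer as ℤ using (ℤ; +_; _+_; _*_)
  import Data.Integer.Properties as ℤP
  open PE using (refl; cong; cong₂; sym; trans)
  open Bivariate
  open SeriesBasics

  ∂ : Ser → Ser
  ∂ f n k = + suc n * f (suc n) k

  ∂-cong : ∀ {f g} → f ≐ g → ∂ f ≐ ∂ g
  ∂-cong p n k = cong (+ suc n *_) (p (suc n) k)

  ∂-⊕ : ∀ f g → ∂ (f ⊕ g) ≐ (∂ f ⊕ ∂ g)
  ∂-⊕ f g n k = ℤP.*-distribˡ-+ (+ suc n) (f (suc n) k) (g (suc n) k)

  ∂-⊝ : ∀ f → ∂ (⊝ f) ≐ (⊝ ∂ f)
  ∂-⊝ f n k = sym (ℤP.neg-distribʳ-* (+ suc n) (f (suc n) k))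

  ∂-const : ∀ f → (∀ n k → f (suc n) k ≡ + 0) → ∂ f ≐ zeroS
  ∂-const f h n k = trans (cong (+ suc n *_) (h n k)) (ℤP.*-zeroʳ (+ suc n))

  ∂-scalar : ∀ c → ∂ (scalar c) ≐ zeroS
  ∂-scalar c = ≐-trans (∂-cong (scalar≐ι c)) (∂-const (ι c) (λ n k → refl))

  ∂X : ∂ X ≐ oneS
  ∂X zero zero = refl
  ∂X zero (suc k) = refl
  ∂X (suc n) k = ℤP.*-zeroʳ (+ suc (suc n))

  infixl 7 _⋆_
  _⋆_ : (ℕ → ℤ) → (ℕ → ℤ) → ℕ → ℤ
  (a ⋆ b) k = sumTo k (λ j → a j * b (k ∸ j))

  sc⋆ˡ : ∀ c a b k → c * (a ⋆ b) k ≡ ((λ j → c * a j) ⋆ b) k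
  sc⋆ˡ c a b k = trans (sumTo-*ˡ k c _) (sumTo-cong k (λ j → sym (ℤP.*-assoc c (a j) _)))

  sc⋆ʳ : ∀ c a b k → c * (a ⋆ b) k ≡ (a ⋆ (λ j → c * b j)) k
  sc⋆ʳ c a b k = trans (sumTo-*ˡ k c _) (sumTo-cong k (λ j →
    trans (sym (ℤP.*-assoc c (a j) _)) (trans (cong (_* b (k ∸ j)) (ℤP.*-comm c (a j))) (ℤP.*-assoc (a j) c _))))

  pos-split : ∀ n i → i ≤ n → + n ≡ + i + + (n ∸ i)
  pos-split n i i≤n = cong +_ (sym (ℕP.m+[n∸m]≡n i≤n))

  -- Leibniz rule: (fg)' = f'g + fg'; the factor n+1 of row n+1 splits as i + (n+1-i)
  leibniz : ∀ f g → ∂ (f ⊛ g) ≐ ((∂ f ⊛ g) ⊕ (f ⊛ ∂ g))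
  leibniz f g n k = begin
    + suc n * sumTo (suc n) term
      ≡⟨ sumTo-*ˡ (suc n) (+ suc n) term ⟩
    sumTo (suc n) (λ i → + suc n * term i)
      ≡⟨ sumTo-cong≤ (suc n) (λ i i≤ → trans (cong (_* term i) (pos-split (suc n) i i≤)) (ℤP.*-distribʳ-+ (term i) (+ i) (+ (suc n ∸ i)))) ⟩
    sumTo (suc n) (λ i → + i * term i + + (suc n ∸ i) * term i)
      ≡⟨ sumTo-+ (suc n) _ _ ⟩
    sumTo (suc n) (λ i → + i * term i) + sumTo (suc n) (λ i → + (suc n ∸ i) * term i)
      ≡⟨ cong₂ _+_ ∂f-part ∂g-part ⟩
    (∂ f ⊛ g) n k + (f ⊛ ∂ g) n k ∎
    where
    open PE.≡-Reasoning
    term : ℕ → ℤ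
    term i = (f i ⋆ g (suc n ∸ i)) k
    ∂f-part : sumTo (suc n) (λ i → + i * term i) ≡ (∂ f ⊛ g) n k
    ∂f-part = begin
      sumTo (suc n) (λ i → + i * term i)                       ≡⟨ sumTo-head n _ ⟩
      + 0 * term 0 + sumTo n (λ i → + suc i * term (suc i))    ≡⟨ ℤP.+-identityˡ _ ⟩
      sumTo n (λ i → + suc i * term (suc i))                   ≡⟨ sumTo-cong n (λ i → sc⋆ˡ (+ suc i) (f (suc i)) (g (n ∸ i)) k) ⟩
      (∂ f ⊛ g) n k                                            ∎
    ∂g-part : sumTo (suc n) (λ i → + (suc n ∸ i) * term i) ≡ (f ⊛ ∂ g) n k
    ∂g-part = begin
      sumTo n (λ i → + (suc n ∸ i) * term i) + + (suc n ∸ suc n) * term (suc n)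
        ≡⟨ cong (λ t → sumTo n (λ i → + (suc n ∸ i) * term i) + + t * term (suc n)) (ℕP.n∸n≡0 n) ⟩
      sumTo n (λ i → + (suc n ∸ i) * term i) + + 0
        ≡⟨ ℤP.+-identityʳ _ ⟩
      sumTo n (λ i → + (suc n ∸ i) * term i)
        ≡⟨ sumTo-cong≤ n (λ i i≤n → trans (sc⋆ʳ (+ (suc n ∸ i)) (f i) (g (suc n ∸ i)) k)
             (sumTo-cong k (λ j → cong (λ t → f i j * (+ t * g t (k ∸ j))) (ℕP.+-∸-assoc 1 i≤n)))) ⟩
      (f ⊛ ∂ g) n k ∎


-- Binomial coefficients via Pascal's rule ('bin', equal to the library's
-- n C k), the absorption identities, and the consequences for Catalan
-- numbers: C(2n,n) = (n+1)·catalan n exactly (so the division in 'catalan'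
-- is exact) and the recurrence (n+2)·catalan(n+1) = 2(2n+1)·catalan n.
module Binomial where
  open import Data.Nat
  open import Data.Nat.Properties
  open import Data.Nat.Combinatorics using (_C_; nCk+nC[k+1]≡[n+1]C[k+1])
  open import Data.Nat.DivMod using (_/_; m*n/n≡m)
  open import Relation.Binary.PropositionalEquality
  open import Data.Nat.Solver
  open +-*-Solver using (solve; _:+_; _:*_; _:=_; con)

  bin : ℕ → ℕ → ℕ
  bin n zero = 1
  bin zero (suc k) = 0
  bin (suc n) (suc k) = bin n k + bin n (suc k)

  bin≡C : ∀ n k → bin n k ≡ n C k
  bin≡C n zero = refl
  bin≡C zero (suc k) = refl
  bin≡C (suc n) (suc k) = trans (cong₂ _+_ (bin≡C n k) (bin≡C n (suc k))) (nCk+nC[k+1]≡[n+1]C[k+1] n k)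

  bin-zero : ∀ n k → n < k → bin n k ≡ 0
  bin-zero zero (suc k) _ = refl
  bin-zero (suc n) (suc k) (s≤s n<k) = cong₂ _+_ (bin-zero n k n<k) (bin-zero n (suc k) (m<n⇒m<1+n n<k))

  bin-1 : ∀ n → bin n 1 ≡ n
  bin-1 zero = refl
  bin-1 (suc n) = cong suc (bin-1 n)

  bin-nn : ∀ n → bin n n ≡ 1
  bin-nn zero = refl
  bin-nn (suc n) = trans (cong₂ _+_ (bin-nn n) (bin-zero n (suc n) (n<1+n n))) refl

  bin-sn : ∀ n → bin (suc n) n ≡ suc n
  bin-sn zero = refl
  bin-sn (suc n) = trans (cong₂ _+_ (bin-sn n) (bin-nn (suc n))) (+-comm (suc n) 1)

  absorb : ∀ n k → suc k * bin (suc n) (suc k) ≡ suc n * bin n k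
  absorb zero zero = refl
  absorb zero (suc k) = *-zeroʳ (suc (suc k))
  absorb (suc n) zero = begin
    1 * (1 + bin (suc n) 1) ≡⟨ solve 1 (λ b → con 1 :* (con 1 :+ b) := con 1 :+ con 1 :* b) refl (bin (suc n) 1) ⟩
    1 + 1 * bin (suc n) 1 ≡⟨ cong (1 +_) (absorb n zero) ⟩
    1 + suc n * 1 ≡⟨ solve 1 (λ n → con 1 :+ (con 1 :+ n) :* con 1 := (con 2 :+ n) :* con 1) refl n ⟩
    suc (suc n) * 1 ∎
    where open ≡-Reasoning
  absorb (suc n) (suc k) = begin
    suc (suc k) * (bin (suc n) (suc k) + bin (suc n) (suc (suc k)))
       ≡⟨ solve 3 (λ k a b → (con 2 :+ k) :* (a :+ b) := a :+ (con 1 :+ k) :* a :+ (con 2 :+ k) :* b) refl k (bin (suc n) (suc k)) (bin (suc n) (suc (suc k))) ⟩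
    bin (suc n) (suc k) + suc k * bin (suc n) (suc k) + suc (suc k) * bin (suc n) (suc (suc k))
       ≡⟨ cong₂ (λ a b → bin (suc n) (suc k) + a + b) (absorb n k) (absorb n (suc k)) ⟩
    bin (suc n) (suc k) + suc n * bin n k + suc n * bin n (suc k)
       ≡⟨ solve 4 (λ n a b c → a :+ (con 1 :+ n) :* b :+ (con 1 :+ n) :* c := a :+ (con 1 :+ n) :* (b :+ c)) refl n (bin (suc n) (suc k)) (bin n k) (bin n (suc k)) ⟩
    bin (suc n) (suc k) + suc n * (bin n k + bin n (suc k)) ≡⟨⟩
    bin (suc n) (suc k) + suc n * bin (suc n) (suc k)
       ≡⟨ solve 2 (λ n a → a :+ (con 1 :+ n) :* a := (con 2 :+ n) :* a) refl n (bin (suc n) (suc k)) ⟩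
    suc (suc n) * bin (suc n) (suc k) ∎
    where open ≡-Reasoning

  bin-step : ∀ m k → suc k * bin m (suc k) + k * bin m k ≡ m * bin m k
  bin-step zero zero = refl
  bin-step zero (suc k) = trans (cong₂ _+_ (*-zeroʳ (suc (suc k))) (*-zeroʳ (suc k))) refl
  bin-step (suc m) zero = trans (+-identityʳ _) (trans (absorb m 0) refl)
  bin-step (suc m) (suc k) = begin
    suc (suc k) * bin (suc m) (suc (suc k)) + suc k * bin (suc m) (suc k)
      ≡⟨ cong₂ _+_ (absorb m (suc k)) (absorb m k) ⟩
    suc m * bin m (suc k) + suc m * bin m k ≡⟨ solve 3 (λ m a b → (con 1 :+ m) :* a :+ (con 1 :+ m) :* b := (con 1 :+ m) :* (b :+ a)) refl m (bin m (suc k)) (bin m k) ⟩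
    suc m * (bin m k + bin m (suc k)) ∎
    where open ≡-Reasoning

  -- C(2n,n) - C(2n,n+1), which is the Catalan number
  catalanQuot : ℕ → ℕ
  catalanQuot n = bin (2 * n) n ∸ bin (2 * n) (suc n)

  catalan-key : ∀ n → suc n * bin (2 * n) (suc n) ≡ n * bin (2 * n) n
  catalan-key n = +-cancelʳ-≡ _ _ _ (trans (bin-step (2 * n) n) (solve 2 (λ n c → con 2 :* n :* c := n :* c :+ n :* c) refl n (bin (2 * n) n)))

  catalan-exact : ∀ n → bin (2 * n) n ≡ catalanQuot n * suc n
  catalan-exact n = sym (begin
    (c ∸ c') * suc n ≡⟨ *-distribʳ-∸ (suc n) c c' ⟩
    c * suc n ∸ c' * suc n ≡⟨ cong₂ _∸_ (*-comm c (suc n)) (trans (*-comm c' (suc n)) (catalan-key n)) ⟩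
    suc n * c ∸ n * c ≡⟨ cong (_∸ n * c) (solve 2 (λ n c → (con 1 :+ n) :* c := c :+ n :* c) refl n c) ⟩
    c + n * c ∸ n * c ≡⟨ m+n∸n≡m c (n * c) ⟩
    c ∎)
    where
    open ≡-Reasoning
    c c' : ℕ
    c = bin (2 * n) n
    c' = bin (2 * n) (suc n)

  catalan≡ : ∀ n → catalan n ≡ catalanQuot n
  catalan≡ n = begin
    ((2 * n) C n) / suc n ≡⟨ cong (_/ suc n) (sym (bin≡C (2 * n) n)) ⟩
    bin (2 * n) n / suc n ≡⟨ cong (_/ suc n) (catalan-exact n) ⟩
    (catalanQuot n * suc n) / suc n ≡⟨ m*n/n≡m (catalanQuot n) (suc n) ⟩
    catalanQuot n ∎
    where open ≡-Reasoning

  catalan-mul : ∀ n → catalan n * suc n ≡ bin (2 * n) n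
  catalan-mul n = trans (cong (_* suc n) (catalan≡ n)) (sym (catalan-exact n))

  central-rec : ∀ m → suc m * bin (2 * suc m) (suc m) ≡ 2 * suc (2 * m) * bin (2 * m) m
  central-rec m = *-cancelˡ-≡ _ _ (suc m) (begin
    suc m * (suc m * bin (2 * suc m) (suc m)) ≡⟨ cong (λ t → suc m * (suc m * bin t (suc m))) e ⟩
    suc m * (suc m * bin (suc (suc (2 * m))) (suc m)) ≡⟨ cong (suc m *_) (absorb (suc (2 * m)) m) ⟩
    suc m * (suc (suc (2 * m)) * bin (suc (2 * m)) m) ≡⟨ cong (λ t → suc m * (suc (suc (2 * m)) * t)) (sym bin-symmetric) ⟩
    suc m * (suc (suc (2 * m)) * bin (suc (2 * m)) (suc m)) ≡⟨ solve 2 (λ m b → (con 1 :+ m) :* ((con 2 :+ con 2 :* m) :* b) := (con 2 :+ con 2 :* m) :* ((con 1 :+ m) :* b)) refl m (bin (suc (2 * m)) (suc m)) ⟩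
    suc (suc (2 * m)) * (suc m * bin (suc (2 * m)) (suc m)) ≡⟨ cong (suc (suc (2 * m)) *_) (absorb (2 * m) m) ⟩
    suc (suc (2 * m)) * (suc (2 * m) * bin (2 * m) m) ≡⟨ solve 2 (λ m b → (con 2 :+ con 2 :* m) :* ((con 1 :+ con 2 :* m) :* b) := (con 1 :+ m) :* (con 2 :* (con 1 :+ con 2 :* m) :* b)) refl m (bin (2 * m) m) ⟩
    suc m * (2 * suc (2 * m) * bin (2 * m) m) ∎)
    where
    open ≡-Reasoning
    e : 2 * suc m ≡ suc (suc (2 * m))
    e = solve 1 (λ m → con 2 :* (con 1 :+ m) := con 2 :+ con 2 :* m) refl m
    bin-symmetric : bin (suc (2 * m)) (suc m) ≡ bin (suc (2 * m)) m
    bin-symmetric = *-cancelˡ-≡ _ _ (suc m) (+-cancelʳ-≡ _ _ _ (trans (bin-step (suc (2 * m)) m)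
            (solve 2 (λ m b → (con 1 :+ con 2 :* m) :* b := (con 1 :+ m) :* b :+ m :* b) refl m (bin (suc (2 * m)) m))))

  catalan-rec : ∀ m → suc (suc m) * catalan (suc m) ≡ 2 * suc (2 * m) * catalan m
  catalan-rec m = *-cancelˡ-≡ _ _ (suc m) (begin
    suc m * (suc (suc m) * catalan (suc m)) ≡⟨ solve 2 (λ m c → (con 1 :+ m) :* ((con 2 :+ m) :* c) := (con 1 :+ m) :* (c :* (con 2 :+ m))) refl m (catalan (suc m)) ⟩
    suc m * (catalan (suc m) * suc (suc m)) ≡⟨ cong (suc m *_) (catalan-mul (suc m)) ⟩
    suc m * bin (2 * suc m) (suc m) ≡⟨ central-rec m ⟩
    2 * suc (2 * m) * bin (2 * m) m ≡⟨ cong (2 * suc (2 * m) *_) (sym (catalan-mul m)) ⟩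
    2 * suc (2 * m) * (catalan m * suc m) ≡⟨ solve 2 (λ m c → con 2 :* (con 1 :+ con 2 :* m) :* (c :* (con 1 :+ m)) := (con 1 :+ m) :* (con 2 :* (con 1 :+ con 2 :* m) :* c)) refl m (catalan m) ⟩
    suc m * (2 * suc (2 * m) * catalan m) ∎)
    where open ≡-Reasoning


-- We avoid manipulating the
-- convolution of Catalan numbers directly: the recurrence
-- (n+2) C_{n+1} = 2(2n+1) C_n says that s = 1 - 2xc solves the linear
-- differential equation (1-4x) s' = -2 s.  Hence both s² and 1-4x solve
-- (1-4x) Z' = -4 Z with Z(0) = 1, and such a solution is unique (its
-- coefficients are determined row by row).  So s² = 1-4x, which expands to
-- 4x (x c² - c + 1) = 0.
module CatalanEquation where
  open import Data.Integer as ℤ using (+_; -_; _+_; _*_)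
  import Data.Integer.Properties as ℤP
  open PE using (refl; cong; cong₂; sym; trans)
  open Bivariate
  open SeriesBasics
  open Derivative
  open Binomial using (catalan-rec)
  open SerSolver using (solve; _:+_; _:*_; _:-_; :-_; _:=_; con)
  open import Data.Integer.Tactic.RingSolver using (solve-∀)

  catalanOp : Ser → Ser
  catalanOp Z = (oneS ⊕ ⊝ (four ⊛ X)) ⊛ ∂ Z

  catalanOp-at : ∀ Z n k → catalanOp Z n k ≡ ∂ Z n k + - (+ 4 * (X ⊛ ∂ Z) n k)
  catalanOp-at Z n k = trans (form n k) (cong (λ t → ∂ Z n k + - t) (scalar-⊛ (+ 4) (X ⊛ ∂ Z) n k))
    where
    form : catalanOp Z ≐ (∂ Z ⊕ ⊝ (four ⊛ (X ⊛ ∂ Z)))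
    form = solve 2 (λ x d → (con (+ 1) :- con (+ 4) :* x) :* d := d :- con (+ 4) :* (x :* d)) ≐-refl X (∂ Z)

  -- uniqueness: a solution of (1-4x) Z' = -4 Z with Z(0) = 0 vanishes, since
  -- row n of the equation reads (n+1) Z_{n+1} - 4n Z_n = -4 Z_n
  catalanOp-unique : ∀ Z → NoConst Z → catalanOp Z ≐ (⊝ (four ⊛ Z)) → Z ≐ zeroS
  catalanOp-unique Z z0 ode = rows
    where
    X⊛∂-zero : ∀ n k → (∀ k → Z n k ≡ + 0) → (X ⊛ ∂ Z) n k ≡ + 0
    X⊛∂-zero zero    k h = X⊛-0 (∂ Z) k
    X⊛∂-zero (suc n) k h = trans (X⊛-suc (∂ Z) n k) (trans (cong (+ suc n *_) (h k)) (ℤP.*-zeroʳ (+ suc n)))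

    next : ∀ n k → (∀ k → Z n k ≡ + 0) → + suc n * Z (suc n) k ≡ + 0
    next n k h = begin
      ∂ Z n k                               ≡⟨ sym (ℤP.+-identityʳ (∂ Z n k)) ⟩
      ∂ Z n k + + 0                         ≡⟨ cong (λ t → ∂ Z n k + - (+ 4 * t)) (sym (X⊛∂-zero n k h)) ⟩
      ∂ Z n k + - (+ 4 * (X ⊛ ∂ Z) n k)     ≡⟨ sym (catalanOp-at Z n k) ⟩
      catalanOp Z n k                       ≡⟨ ode n k ⟩
      - (four ⊛ Z) n k                      ≡⟨ cong -_ (scalar-⊛ (+ 4) Z n k) ⟩
      - (+ 4 * Z n k)                       ≡⟨ cong (λ t → - (+ 4 * t)) (h k) ⟩
      + 0                                   ∎
      where open PE.≡-Reasoning

    rows : ∀ n k → Z n k ≡ + 0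
    rows zero    k = z0 k
    rows (suc n) k = suc-cancel n (Z (suc n) k) (next n k (rows n))

  s : Ser
  s = oneS ⊕ ⊝ (two ⊛ (X ⊛ cS))

  s-0 : ∀ k → s 0 k ≡ oneS 0 k
  s-0 k = trans (cong (λ t → oneS 0 k + - t) (trans (scalar-⊛ (+ 2) (X ⊛ cS) 0 k) (cong (+ 2 *_) (X⊛-0 cS k))))
                (ℤP.+-identityʳ _)

  s-suc : ∀ n k → s (suc n) k ≡ - (+ 2 * cS n k)
  s-suc n k = trans (cong (λ t → + 0 + - t) (trans (scalar-⊛ (+ 2) (X ⊛ cS) (suc n) k) (cong (+ 2 *_) (X⊛-suc cS n k))))
                    (ℤP.+-identityˡ _)

  cS-rec : ∀ m k → + suc (suc m) * cS (suc m) k ≡ (+ 2 + + 4 * + m) * cS m k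
  cS-rec m zero    = trans (sym (ℤP.pos-* (suc (suc m)) (catalan (suc m))))
                       (trans (cong +_ (catalan-rec m)) (trans (ℤP.pos-* (2 ℕ.* suc (2 ℕ.* m)) (catalan m))
                         (cong (_* cS m zero) two[2m+1])))
    where
    two[2m+1] : + (2 ℕ.* suc (2 ℕ.* m)) ≡ + 2 + + 4 * + m
    two[2m+1] = trans (cong +_ (ℕP.*-distribˡ-+ 2 1 (2 ℕ.* m))) (trans (ℤP.pos-+ 2 (2 ℕ.* (2 ℕ.* m)))
      (cong (λ t → + 2 + t) (trans (cong +_ (PE.sym (ℕP.*-assoc 2 2 m))) (ℤP.pos-* 4 m))))
  cS-rec m (suc k) = trans (ℤP.*-zeroʳ (+ suc (suc m))) (sym (ℤP.*-zeroʳ (+ 2 + + 4 * + m)))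

  s-ode-expand : ∀ mm a b c → a * - (+ 2 * b) + - (+ 4 * ((+ 1 + mm) * - (+ 2 * c))) ≡ - (+ 2 * (a * b)) + + 8 * (+ 1 + mm) * c
  s-ode-expand = solve-∀

  s-ode-collect : ∀ mm c → - (+ 2 * ((+ 2 + + 4 * mm) * c)) + + 8 * (+ 1 + mm) * c ≡ - (+ 2 * - (+ 2 * c))
  s-ode-collect = solve-∀

  s-ode : catalanOp s ≐ (⊝ (two ⊛ s))
  s-ode zero k = begin
    catalanOp s 0 k                               ≡⟨ catalanOp-at s 0 k ⟩
    + 1 * s 1 k + - (+ 4 * (X ⊛ ∂ s) 0 k)         ≡⟨ cong₂ (λ a b → + 1 * a + - (+ 4 * b)) (s-suc 0 k) (X⊛-0 (∂ s) k) ⟩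
    + 1 * - (+ 2 * cS 0 k) + - (+ 4 * + 0)        ≡⟨ row0 k ⟩
    - (+ 2 * oneS 0 k)                            ≡⟨ cong (λ t → - (+ 2 * t)) (sym (s-0 k)) ⟩
    - (+ 2 * s 0 k)                               ≡⟨ cong -_ (sym (scalar-⊛ (+ 2) s 0 k)) ⟩
    - (two ⊛ s) 0 k                               ∎
    where
    open PE.≡-Reasoning
    row0 : ∀ k → + 1 * - (+ 2 * cS 0 k) + - (+ 4 * + 0) ≡ - (+ 2 * oneS 0 k)
    row0 zero    = refl
    row0 (suc k) = refl
  s-ode (suc m) k = begin
    catalanOp s (suc m) k
      ≡⟨ catalanOp-at s (suc m) k ⟩
    + suc (suc m) * s (suc (suc m)) k + - (+ 4 * (X ⊛ ∂ s) (suc m) k)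
      ≡⟨ cong₂ (λ a b → + suc (suc m) * a + - (+ 4 * b)) (s-suc (suc m) k)
               (trans (X⊛-suc (∂ s) m k) (cong (+ suc m *_) (s-suc m k))) ⟩
    + suc (suc m) * - (+ 2 * cS (suc m) k) + - (+ 4 * (+ suc m * - (+ 2 * cS m k)))
      ≡⟨ s-ode-expand (+ m) (+ suc (suc m)) (cS (suc m) k) (cS m k) ⟩
    - (+ 2 * (+ suc (suc m) * cS (suc m) k)) + + 8 * (+ 1 + + m) * cS m k
      ≡⟨ cong (λ t → - (+ 2 * t) + + 8 * (+ 1 + + m) * cS m k) (cS-rec m k) ⟩
    - (+ 2 * ((+ 2 + + 4 * + m) * cS m k)) + + 8 * (+ 1 + + m) * cS m k
      ≡⟨ s-ode-collect (+ m) (cS m k) ⟩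
    - (+ 2 * - (+ 2 * cS m k))
      ≡⟨ cong (λ t → - (+ 2 * t)) (sym (s-suc m k)) ⟩
    - (+ 2 * s (suc m) k)
      ≡⟨ cong -_ (sym (scalar-⊛ (+ 2) s (suc m) k)) ⟩
    - (two ⊛ s) (suc m) k ∎
    where open PE.≡-Reasoning

  oneMinus4x squareDiff : Ser
  oneMinus4x = oneS ⊕ ⊝ (four ⊛ X)
  squareDiff = s ⊛ s ⊕ ⊝ oneMinus4x

  square-ode : catalanOp (s ⊛ s) ≐ (⊝ (four ⊛ (s ⊛ s)))
  square-ode = begin
    catalanOp (s ⊛ s)                          ≈⟨ ⊛-l oneMinus4x (leibniz s s) ⟩
    oneMinus4x ⊛ ((∂ s ⊛ s) ⊕ (s ⊛ ∂ s))       ≈⟨ solve 3 (λ x s d → (con (+ 1) :- con (+ 4) :* x) :* (d :* s :+ s :* d)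
                                                                   := con (+ 2) :* s :* ((con (+ 1) :- con (+ 4) :* x) :* d))
                                                           ≐-refl X s (∂ s) ⟩
    two ⊛ s ⊛ catalanOp s                      ≈⟨ ⊛-l (two ⊛ s) s-ode ⟩
    two ⊛ s ⊛ (⊝ (two ⊛ s))                    ≈⟨ solve 1 (λ s → con (+ 2) :* s :* (:- (con (+ 2) :* s)) := :- (con (+ 4) :* (s :* s))) ≐-refl s ⟩
    ⊝ (four ⊛ (s ⊛ s))                         ∎
    where open ≐-Reasoning

  oneMinus4x-ode : catalanOp oneMinus4x ≐ (⊝ (four ⊛ oneMinus4x))
  oneMinus4x-ode = ≐-trans (⊛-l oneMinus4x ∂oneMinus4x)
     (solve 1 (λ x → (con (+ 1) :- con (+ 4) :* x) :* (:- con (+ 4)) := :- (con (+ 4) :* (con (+ 1) :- con (+ 4) :* x))) ≐-refl X)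
    where
    ∂oneMinus4x : ∂ oneMinus4x ≐ (⊝ four)
    ∂oneMinus4x = begin
      ∂ oneMinus4x                           ≈⟨ ∂-⊕ oneS (⊝ (four ⊛ X)) ⟩
      ∂ oneS ⊕ ∂ (⊝ (four ⊛ X))              ≈⟨ ⊕c (∂-const oneS (λ n k → refl))
                                                   (≐-trans (∂-⊝ (four ⊛ X)) (⊝c (≐-trans (leibniz four X) (⊕c (⊛-r X (∂-scalar (+ 4))) (⊛-l four ∂X))))) ⟩
      zeroS ⊕ ⊝ (zeroS ⊛ X ⊕ four ⊛ oneS)    ≈⟨ solve 1 (λ x → con (+ 0) :- (con (+ 0) :* x :+ con (+ 4) :* con (+ 1)) := :- con (+ 4)) ≐-refl X ⟩
      ⊝ four                                 ∎
      where open ≐-Reasoning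

  squareDiff-ode : catalanOp squareDiff ≐ (⊝ (four ⊛ squareDiff))
  squareDiff-ode = begin
    catalanOp squareDiff
      ≈⟨ ⊛-l oneMinus4x (≐-trans (∂-⊕ (s ⊛ s) (⊝ oneMinus4x)) (⊕-l (∂ (s ⊛ s)) (∂-⊝ oneMinus4x))) ⟩
    oneMinus4x ⊛ (∂ (s ⊛ s) ⊕ ⊝ ∂ oneMinus4x)
      ≈⟨ solve 3 (λ x a b → (con (+ 1) :- con (+ 4) :* x) :* (a :- b) := (con (+ 1) :- con (+ 4) :* x) :* a :- (con (+ 1) :- con (+ 4) :* x) :* b)
                 ≐-refl X (∂ (s ⊛ s)) (∂ oneMinus4x) ⟩
    catalanOp (s ⊛ s) ⊕ ⊝ catalanOp oneMinus4x
      ≈⟨ ⊕c square-ode (⊝c oneMinus4x-ode) ⟩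
    ⊝ (four ⊛ (s ⊛ s)) ⊕ ⊝ (⊝ (four ⊛ oneMinus4x))
      ≈⟨ solve 2 (λ a b → :- (con (+ 4) :* a) :- :- (con (+ 4) :* b) := :- (con (+ 4) :* (a :- b))) ≐-refl (s ⊛ s) oneMinus4x ⟩
    ⊝ (four ⊛ squareDiff) ∎
    where open ≐-Reasoning

  squareDiff-0 : NoConst squareDiff
  squareDiff-0 k = begin
    (s ⊛ s) 0 k + - oneMinus4x 0 k   ≡⟨ cong₂ (λ a b → a + - b) s²-0 oneMinus4x-0 ⟩
    oneS 0 k + - oneS 0 k            ≡⟨ ℤP.+-inverseʳ (oneS 0 k) ⟩
    + 0                              ∎
    where
    open PE.≡-Reasoning
    s-row0 : ∀ i k' → i ≤ 0 → s i k' ≡ oneS i k'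
    s-row0 zero k' _ = s-0 k'
    s²-0 : (s ⊛ s) 0 k ≡ oneS 0 k
    s²-0 = trans (⊛-local s s oneS 0 s-row0 k)
             (trans (⊛-comm s oneS 0 k) (trans (⊛-local oneS s oneS 0 s-row0 k) (⊛-identityˡ oneS 0 k)))
    oneMinus4x-0 : oneMinus4x 0 k ≡ oneS 0 k
    oneMinus4x-0 = trans (cong (λ t → oneS 0 k + - t) (scalar-⊛ (+ 4) X 0 k)) (ℤP.+-identityʳ _)

  squareDiff≐0 : squareDiff ≐ zeroS
  squareDiff≐0 = catalanOp-unique squareDiff squareDiff-0 squareDiff-ode

  catalan-functional : cS ≐ (oneS ⊕ X ⊛ cS ⊛ cS)
  catalan-functional = ≐-trans (≐-sym (+zero⊛ cS defect oneS defect≐0))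
    (solve 2 (λ x c → c :+ (x :* c :* c :- c :+ con (+ 1)) :* con (+ 1) := con (+ 1) :+ x :* c :* c) ≐-refl X cS)
    where
    defect : Ser
    defect = X ⊛ cS ⊛ cS ⊕ ⊝ cS ⊕ oneS
    squareDiff-expand : squareDiff ≐ (four ⊛ (X ⊛ defect))
    squareDiff-expand = solve 2 (λ x c → (con (+ 1) :- con (+ 2) :* (x :* c)) :* (con (+ 1) :- con (+ 2) :* (x :* c)) :- (con (+ 1) :- con (+ 4) :* x)
                                         := con (+ 4) :* (x :* (x :* c :* c :- c :+ con (+ 1)))) ≐-refl X cS
    X⊛defect≐0 : ∀ n k → (X ⊛ defect) n k ≡ + 0
    X⊛defect≐0 n k = suc-cancel 3 ((X ⊛ defect) n k)
      (trans (sym (scalar-⊛ (+ 4) (X ⊛ defect) n k)) (trans (sym (squareDiff-expand n k)) (squareDiff≐0 n k)))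
    defect≐0 : defect ≐ zeroS
    defect≐0 n k = trans (sym (X⊛-suc defect n k)) (X⊛defect≐0 (suc n) k)


-- Writing u = x R and clearing the denominator of h(u) = (1+ru)/(1+(r+1)u),
-- the equation becomes x · Q(R) = 0 for the quadratic
--   Q(R) = r x R² + (1 - (r+1)x) R - 1.
-- This quadratic has at most one solution (the difference of two solutions
-- is annihilated by an invertible series), and the closed form
--   T = c(w) / (1 - (r+1)x),   w = -r x / (1 - (r+1)x)²,
-- is one, because c(w) = 1 + w c(w)².
module QuadraticEquation where
  open import Data.Integer as ℤ using (+_)
  import Data.Integer.Properties as ℤP
  open Bivariate
  open SeriesBasics
  open Composition
  open InverseBinomial using (r1x; hNum; noConst-r1x)
  open CatalanEquation using (catalan-functional)
  open SerSolver using (solve; _:+_; _:*_; _:-_; :-_; _:=_; con)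

  α α⁻¹ : Ser
  α   = oneS ⊕ ⊝ r1x
  α⁻¹ = inv1+ (⊝ r1x)

  α⊛α⁻¹ : (α ⊛ α⁻¹) ≐ oneS
  α⊛α⁻¹ = inv1+-inverse (⊝ r1x) (noConst-⊝ r1x noConst-r1x)

  quadratic : Ser → Ser
  quadratic R = Rv ⊛ X ⊛ R ⊛ R ⊕ α ⊛ R ⊕ ⊝ oneS

  w cw closedForm : Ser
  w          = ⊝ (Rv ⊛ X) ⊛ α⁻¹ ⊛ α⁻¹
  cw         = cS ∘S w
  closedForm = α⁻¹ ⊛ cw

  noConst-w : NoConst w
  noConst-w = noConst-⊛ˡ (⊝ (Rv ⊛ X) ⊛ α⁻¹) α⁻¹ (noConst-⊛ˡ (⊝ (Rv ⊛ X)) α⁻¹ (noConst-⊝ (Rv ⊛ X) (noConst-⊛ʳ Rv X noConst-X)))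

  cw-functional : cw ≐ (oneS ⊕ w ⊛ cw ⊛ cw)
  cw-functional = begin
    cS ∘S w                               ≈⟨ ∘-congˡ w catalan-functional ⟩
    (oneS ⊕ X ⊛ cS ⊛ cS) ∘S w             ≈⟨ ∘-⊕ oneS (X ⊛ cS ⊛ cS) w ⟩
    (oneS ∘S w) ⊕ ((X ⊛ cS ⊛ cS) ∘S w)    ≈⟨ ⊕c (one-∘ w noConst-w)
                                               (≐-trans (∘-⊛ w noConst-w (X ⊛ cS) cS) (⊛-r cw (≐-trans (∘-⊛ w noConst-w X cS) (⊛-r cw (X-∘ w noConst-w))))) ⟩
    oneS ⊕ w ⊛ cw ⊛ cw                    ∎
    where open ≐-Reasoning

  closedForm-quadratic : quadratic closedForm ≐ zeroS
  closedForm-quadratic = begin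
    quadratic closedForm
      ≈⟨ solve 4 (λ r x a c → r :* x :* (a :* c) :* (a :* c) :+ (con (+ 1) :- (r :+ con (+ 1)) :* x) :* (a :* c) :- con (+ 1)
                    := (c :- (con (+ 1) :+ :- (r :* x) :* a :* a :* c :* c)) :+ ((con (+ 1) :- (r :+ con (+ 1)) :* x) :* a :- con (+ 1)) :* c)
                 ≐-refl Rv X α⁻¹ cw ⟩
    (cw ⊕ ⊝ (oneS ⊕ w ⊛ cw ⊛ cw)) ⊕ (α ⊛ α⁻¹ ⊕ ⊝ oneS) ⊛ cw
      ≈⟨ +zero⊛ (cw ⊕ ⊝ (oneS ⊕ w ⊛ cw ⊛ cw)) (α ⊛ α⁻¹ ⊕ ⊝ oneS) cw
                (≐-trans (⊕-r (⊝ oneS) α⊛α⁻¹) (solve 0 (con (+ 1) :- con (+ 1) := con (+ 0)) ≐-refl)) ⟩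
    cw ⊕ ⊝ (oneS ⊕ w ⊛ cw ⊛ cw)
      ≈⟨ ⊕-r (⊝ (oneS ⊕ w ⊛ cw ⊛ cw)) cw-functional ⟩
    (oneS ⊕ w ⊛ cw ⊛ cw) ⊕ ⊝ (oneS ⊕ w ⊛ cw ⊛ cw)
      ≈⟨ solve 1 (λ a → a :- a := con (+ 0)) ≐-refl (oneS ⊕ w ⊛ cw ⊛ cw) ⟩
    zeroS ∎
    where open ≐-Reasoning

  -- Q has at most one root: Q(R) - Q(T) = (1 + G) (R - T) with G(0) = 0
  quadratic-unique : ∀ R T → quadratic R ≐ zeroS → quadratic T ≐ zeroS → R ≐ T
  quadratic-unique R T QR QT n k = ℤP.i-j≡0⇒i≡j (R n k) (T n k) (cancel-1+ G (R ⊕ ⊝ T) noConst-G factored n k)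
    where
    G : Ser
    G = ⊝ r1x ⊕ Rv ⊛ X ⊛ (R ⊕ T)
    noConst-G : NoConst G
    noConst-G = noConst-⊕ (⊝ r1x) (Rv ⊛ X ⊛ (R ⊕ T)) (noConst-⊝ r1x noConst-r1x)
                          (noConst-⊛ˡ (Rv ⊛ X) (R ⊕ T) (noConst-⊛ʳ Rv X noConst-X))
    factored : ((oneS ⊕ G) ⊛ (R ⊕ ⊝ T)) ≐ zeroS
    factored = begin
      (oneS ⊕ G) ⊛ (R ⊕ ⊝ T)
        ≈⟨ solve 4 (λ r x R T → (con (+ 1) :+ (:- ((r :+ con (+ 1)) :* x) :+ r :* x :* (R :+ T))) :* (R :- T)
                    := (r :* x :* R :* R :+ (con (+ 1) :- (r :+ con (+ 1)) :* x) :* R :- con (+ 1))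
                       :- (r :* x :* T :* T :+ (con (+ 1) :- (r :+ con (+ 1)) :* x) :* T :- con (+ 1)))
                   ≐-refl Rv X R T ⟩
      quadratic R ⊕ ⊝ quadratic T   ≈⟨ ⊕c QR (⊝c QT) ⟩
      zeroS ⊕ ⊝ zeroS               ≈⟨ solve 0 (con (+ 0) :- con (+ 0) := con (+ 0)) ≐-refl ⟩
      zeroS                         ∎
      where open ≐-Reasoning

  h-∘ : ∀ v → NoConst v → (hS ∘S v) ≐ ((oneS ⊕ Rv ⊛ v) ⊛ inv1+ ((Rv ⊕ oneS) ⊛ v))
  h-∘ v z = ≐-trans (∘-⊛ v z hNum (inv1+ r1x)) (⊛-cong numerator (≐-trans (inv-∘ r1x v z noConst-r1x) (inv1+-cong denominator)))
    where
    numerator : (hNum ∘S v) ≐ (oneS ⊕ Rv ⊛ v)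
    numerator = ≐-trans (∘-⊕ oneS (Rv ⊛ X) v) (⊕c (one-∘ v z) (≐-trans (∘-⊛ v z Rv X) (⊛-cong (Rv-∘ v z) (X-∘ v z))))
    denominator : (r1x ∘S v) ≐ ((Rv ⊕ oneS) ⊛ v)
    denominator = ≐-trans (∘-⊛ v z (Rv ⊕ oneS) X) (⊛-cong (≐-trans (∘-⊕ Rv oneS v) (⊕c (Rv-∘ v z) (one-∘ v z))) (X-∘ v z))

  -- the cleared form of u h(u) = x for u = x R is  x Q(R) = 0
  X⊛quadratic : ∀ R → (X ⊛ quadratic R) ≐
                ((X ⊛ R) ⊛ (oneS ⊕ Rv ⊛ (X ⊛ R)) ⊕ ⊝ (X ⊛ (oneS ⊕ (Rv ⊕ oneS) ⊛ (X ⊛ R))))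
  X⊛quadratic R = solve 3 (λ x t r → x :* (r :* x :* t :* t :+ (con (+ 1) :- (r :+ con (+ 1)) :* x) :* t :- con (+ 1))
                                     := (x :* t) :* (con (+ 1) :+ r :* (x :* t)) :- x :* (con (+ 1) :+ (r :+ con (+ 1)) :* (x :* t)))
                          ≐-refl X R Rv

  quadratic⇒solves : ∀ R → quadratic R ≐ zeroS → ((X ⊛ R) ⊛ (hS ∘S (X ⊛ R))) ≐ X
  quadratic⇒solves R QR = begin
    u ⊛ (hS ∘S u)               ≈⟨ ⊛-l u (h-∘ u noConst-u) ⟩
    u ⊛ ((oneS ⊕ Rv ⊛ u) ⊛ L)   ≈⟨ solve 3 (λ u r l → u :* ((con (+ 1) :+ r :* u) :* l) := (u :* (con (+ 1) :+ r :* u)) :* l) ≐-refl u Rv L ⟩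
    (u ⊛ (oneS ⊕ Rv ⊛ u)) ⊛ L   ≈⟨ ⊛-r L cleared ⟩
    (X ⊛ A) ⊛ L                 ≈⟨ solve 3 (λ x a l → (x :* a) :* l := x :* (a :* l)) ≐-refl X A L ⟩
    X ⊛ (A ⊛ L)                 ≈⟨ ⊛-l X (inv1+-inverse ((Rv ⊕ oneS) ⊛ u) (noConst-⊛ʳ (Rv ⊕ oneS) u noConst-u)) ⟩
    X ⊛ oneS                    ≈⟨ solve 1 (λ x → x :* con (+ 1) := x) ≐-refl X ⟩
    X                           ∎
    where
    open ≐-Reasoning
    u A L : Ser
    u = X ⊛ R
    A = oneS ⊕ (Rv ⊕ oneS) ⊛ u
    L = inv1+ ((Rv ⊕ oneS) ⊛ u)
    noConst-u : NoConst u
    noConst-u = noConst-⊛ˡ X R noConst-X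
    cleared : (u ⊛ (oneS ⊕ Rv ⊛ u)) ≐ (X ⊛ A)
    cleared = begin
      u ⊛ (oneS ⊕ Rv ⊛ u)                   ≈⟨ solve 2 (λ p q → p := q :+ (p :- q)) ≐-refl (u ⊛ (oneS ⊕ Rv ⊛ u)) (X ⊛ A) ⟩
      X ⊛ A ⊕ (u ⊛ (oneS ⊕ Rv ⊛ u) ⊕ ⊝ (X ⊛ A))
                                            ≈⟨ ⊕-l (X ⊛ A) (≐-sym (X⊛quadratic R)) ⟩
      X ⊛ A ⊕ X ⊛ quadratic R               ≈⟨ ⊕-l (X ⊛ A) (⊛-l X QR) ⟩
      X ⊛ A ⊕ X ⊛ zeroS                     ≈⟨ solve 2 (λ a x → a :+ x :* con (+ 0) := a) ≐-refl (X ⊛ A) X ⟩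
      X ⊛ A                                 ∎

  solves⇒quadratic : ∀ u → NoConst u → (u ⊛ (hS ∘S u)) ≐ X → quadratic (tailX u) ≐ zeroS
  solves⇒quadratic u z hu = X-cancel (quadratic R) zeroS (begin
    X ⊛ quadratic R
      ≈⟨ X⊛quadratic R ⟩
    (X ⊛ R) ⊛ (oneS ⊕ Rv ⊛ (X ⊛ R)) ⊕ ⊝ (X ⊛ (oneS ⊕ (Rv ⊕ oneS) ⊛ (X ⊛ R)))
      ≈⟨ ≐-sym (⊕c (⊛-cong u≐XR (⊕-l oneS (⊛-l Rv u≐XR))) (⊝c (⊛-l X (⊕-l oneS (⊛-l (Rv ⊕ oneS) u≐XR))))) ⟩
    u ⊛ (oneS ⊕ Rv ⊛ u) ⊕ ⊝ (X ⊛ A)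
      ≈⟨ ⊕-r (⊝ (X ⊛ A)) cleared ⟩
    X ⊛ A ⊕ ⊝ (X ⊛ A)
      ≈⟨ solve 2 (λ a x → a :- a := x :* con (+ 0)) ≐-refl (X ⊛ A) X ⟩
    X ⊛ zeroS ∎)
    where
    open ≐-Reasoning
    R A L : Ser
    R = tailX u
    A = oneS ⊕ (Rv ⊕ oneS) ⊛ u
    L = inv1+ ((Rv ⊕ oneS) ⊛ u)
    u≐XR : u ≐ (X ⊛ R)
    u≐XR = noConst⇒X⊛tail u z
    -- multiply u (1+ru) L = x by A = 1 + (r+1) u, using A L = 1
    cleared : (u ⊛ (oneS ⊕ Rv ⊛ u)) ≐ (X ⊛ A)
    cleared = begin
      u ⊛ (oneS ⊕ Rv ⊛ u)               ≈⟨ solve 1 (λ p → p := p :* con (+ 1)) ≐-refl (u ⊛ (oneS ⊕ Rv ⊛ u)) ⟩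
      (u ⊛ (oneS ⊕ Rv ⊛ u)) ⊛ oneS      ≈⟨ ⊛-l (u ⊛ (oneS ⊕ Rv ⊛ u)) (≐-sym (inv1+-inverse ((Rv ⊕ oneS) ⊛ u) (noConst-⊛ʳ (Rv ⊕ oneS) u z))) ⟩
      (u ⊛ (oneS ⊕ Rv ⊛ u)) ⊛ (A ⊛ L)   ≈⟨ solve 4 (λ u r a l → (u :* (con (+ 1) :+ r :* u)) :* (a :* l) := (u :* ((con (+ 1) :+ r :* u) :* l)) :* a)
                                                   ≐-refl u Rv A L ⟩
      (u ⊛ ((oneS ⊕ Rv ⊛ u) ⊛ L)) ⊛ A   ≈⟨ ⊛-r A (≐-trans (⊛-l u (≐-sym (h-∘ u z))) hu) ⟩
      X ⊛ A                             ∎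


-- Differentiating
-- Q(R) = 0 and eliminating R² shows that every root R of Q satisfies
--   x (α² + 4rx) R' + (1 + (r-1)x) R = 1 + (r+1)x,
-- where α² + 4rx = 1 + 2(r-1)x + (r+1)²x² is the discriminant of Q.
module NarayanaODE where
  open import Data.Integer as ℤ using (ℤ; +_; _*_)
  open PE using (refl; cong; trans)
  open Bivariate
  open SeriesBasics
  open Derivative
  open InverseBinomial using (r1x)
  open QuadraticEquation using (quadratic; α)
  open SerSolver using (solve; _:+_; _:*_; _:-_; :-_; _:=_; con)

  -- the discriminant α² + 4rx
  disc : Ser
  disc = oneS ⊕ two ⊛ (Rv ⊕ ⊝ oneS) ⊛ X ⊕ (Rv ⊕ oneS) ⊛ (Rv ⊕ oneS) ⊛ X ⊛ X

  narOp : Ser → Ser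
  narOp Z = X ⊛ disc ⊛ ∂ Z ⊕ (oneS ⊕ (Rv ⊕ ⊝ oneS) ⊛ X) ⊛ Z

  narRhs : Ser
  narRhs = oneS ⊕ (Rv ⊕ oneS) ⊛ X

  narOp-linear : ∀ A B → narOp (A ⊕ ⊝ B) ≐ (narOp A ⊕ ⊝ narOp B)
  narOp-linear A B = ≐-trans (⊕-r ((oneS ⊕ (Rv ⊕ ⊝ oneS) ⊛ X) ⊛ (A ⊕ ⊝ B)) (⊛-l (X ⊛ disc) (≐-trans (∂-⊕ A (⊝ B)) (⊕-l (∂ A) (∂-⊝ B)))))
     (solve 7 (λ r x dp da db a b → x :* dp :* (da :- db) :+ (con (+ 1) :+ (r :- con (+ 1)) :* x) :* (a :- b)
        := (x :* dp :* da :+ (con (+ 1) :+ (r :- con (+ 1)) :* x) :* a) :- (x :* dp :* db :+ (con (+ 1) :+ (r :- con (+ 1)) :* x) :* b))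
        ≐-refl Rv X disc (∂ A) (∂ B) A B)

  ∂rX : ∂ (Rv ⊛ X) ≐ Rv
  ∂rX = ≐-trans (leibniz Rv X) (≐-trans (⊕c (⊛-r X (∂-const Rv (λ n k → refl))) (⊛-l Rv ∂X))
                 (solve 2 (λ x r → con (+ 0) :* x :+ r :* con (+ 1) := r) ≐-refl X Rv))

  ∂α : ∂ α ≐ (⊝ (Rv ⊕ oneS))
  ∂α = ≐-trans (∂-⊕ oneS (⊝ r1x)) (≐-trans (⊕c (∂-const oneS (λ n k → refl)) (≐-trans (∂-⊝ r1x) (⊝c ∂r1x)))
               (solve 1 (λ r → con (+ 0) :- (r :+ con (+ 1)) := :- (r :+ con (+ 1))) ≐-refl Rv))
    where
    ∂r1x : ∂ r1x ≐ (Rv ⊕ oneS)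
    ∂r1x = ≐-trans (leibniz (Rv ⊕ oneS) X)
             (≐-trans (⊕c (⊛-r X (∂-const (Rv ⊕ oneS) (λ n k → refl))) (⊛-l (Rv ⊕ oneS) ∂X))
               (solve 2 (λ x r → con (+ 0) :* x :+ (r :+ con (+ 1)) :* con (+ 1) := r :+ con (+ 1)) ≐-refl X Rv))

  ∂quadratic : ∀ R → ∂ (quadratic R) ≐ (Rv ⊛ R ⊛ R ⊕ (two ⊛ Rv ⊛ X ⊛ R ⊕ α) ⊛ ∂ R ⊕ ⊝ ((Rv ⊕ oneS) ⊛ R))
  ∂quadratic R = begin
    ∂ (quadratic R)
      ≈⟨ ≐-trans (∂-⊕ (Rv ⊛ X ⊛ R ⊛ R ⊕ α ⊛ R) (⊝ oneS)) (⊕c (∂-⊕ (Rv ⊛ X ⊛ R ⊛ R) (α ⊛ R)) (∂-⊝ oneS)) ⟩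
    (∂ (Rv ⊛ X ⊛ R ⊛ R) ⊕ ∂ (α ⊛ R)) ⊕ ⊝ ∂ oneS
      ≈⟨ ⊕c (⊕c (≐-trans (leibniz (Rv ⊛ X ⊛ R) R) (⊕-r (Rv ⊛ X ⊛ R ⊛ ∂ R) (⊛-r R (≐-trans (leibniz (Rv ⊛ X) R) (⊕-r (Rv ⊛ X ⊛ ∂ R) (⊛-r R ∂rX))))))
                (≐-trans (leibniz α R) (⊕-r (α ⊛ ∂ R) (⊛-r R ∂α))))
            (⊝c (∂-const oneS (λ n k → refl))) ⟩
    ((Rv ⊛ R ⊕ Rv ⊛ X ⊛ ∂ R) ⊛ R ⊕ Rv ⊛ X ⊛ R ⊛ ∂ R ⊕ (⊝ (Rv ⊕ oneS) ⊛ R ⊕ α ⊛ ∂ R)) ⊕ ⊝ zeroS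
      ≈⟨ solve 5 (λ r x R d a → ((r :* R :+ r :* x :* d) :* R :+ r :* x :* R :* d :+ (:- (r :+ con (+ 1)) :* R :+ a :* d)) :- con (+ 0)
                                := r :* R :* R :+ (con (+ 2) :* r :* x :* R :+ a) :* d :- (r :+ con (+ 1)) :* R)
                 ≐-refl Rv X R (∂ R) α ⟩
    Rv ⊛ R ⊛ R ⊕ (two ⊛ Rv ⊛ X ⊛ R ⊕ α) ⊛ ∂ R ⊕ ⊝ ((Rv ⊕ oneS) ⊛ R) ∎
    where open ≐-Reasoning

  -- a root of Q solves the linear equation:
  -- narOp R - narRhs = x S Q(R)' - Q(R) W  with  S = α + 2rxR,  W = 4rx²R' + S - 2
  quadratic⇒narOp : ∀ R → quadratic R ≐ zeroS → narOp R ≐ narRhs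
  quadratic⇒narOp R QR = begin
    narOp R
      ≈⟨ solve 4 (λ r x R d →
           x :* (con (+ 1) :+ con (+ 2) :* (r :- con (+ 1)) :* x :+ (r :+ con (+ 1)) :* (r :+ con (+ 1)) :* x :* x) :* d :+ (con (+ 1) :+ (r :- con (+ 1)) :* x) :* R
           := (con (+ 1) :+ (r :+ con (+ 1)) :* x) :+
              (x :* ((con (+ 1) :- (r :+ con (+ 1)) :* x) :+ con (+ 2) :* r :* x :* R) :*
                 (r :* R :* R :+ (con (+ 2) :* r :* x :* R :+ (con (+ 1) :- (r :+ con (+ 1)) :* x)) :* d :- (r :+ con (+ 1)) :* R)
               :- (r :* x :* R :* R :+ (con (+ 1) :- (r :+ con (+ 1)) :* x) :* R :- con (+ 1)) :*
                  (con (+ 4) :* r :* x :* x :* d :+ ((con (+ 1) :- (r :+ con (+ 1)) :* x) :+ con (+ 2) :* r :* x :* R) :- con (+ 2))))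
           ≐-refl Rv X R (∂ R) ⟩
    narRhs ⊕ (X ⊛ S ⊛ Q′ ⊕ ⊝ (quadratic R ⊛ W))
      ≈⟨ ⊕-l narRhs (⊕c (⊛-l (X ⊛ S) Q′≐0) (⊝c (⊛-r W QR))) ⟩
    narRhs ⊕ (X ⊛ S ⊛ zeroS ⊕ ⊝ (zeroS ⊛ W))
      ≈⟨ solve 3 (λ a b c → a :+ (b :* con (+ 0) :- con (+ 0) :* c) := a) ≐-refl narRhs (X ⊛ S) W ⟩
    narRhs ∎
    where
    open ≐-Reasoning
    S W Q′ : Ser
    S  = α ⊕ two ⊛ Rv ⊛ X ⊛ R
    W  = four ⊛ Rv ⊛ X ⊛ X ⊛ ∂ R ⊕ S ⊕ ⊝ two
    Q′ = Rv ⊛ R ⊛ R ⊕ (two ⊛ Rv ⊛ X ⊛ R ⊕ α) ⊛ ∂ R ⊕ ⊝ ((Rv ⊕ oneS) ⊛ R)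
    Q′≐0 : Q′ ≐ zeroS
    Q′≐0 = ≐-trans (≐-sym (∂quadratic R)) (≐-trans (∂-cong QR) (∂-const zeroS (λ n k → refl)))

  shX : Ser → Ser
  shX G zero    k = + 0
  shX G (suc n) k = G n k

  shR : Ser → Ser
  shR G n zero    = + 0
  shR G n (suc k) = G n k

  scale : ℤ → Ser → Ser
  scale c G n k = c * G n k

  X⊛≐shX : ∀ {G H} → G ≐ H → (X ⊛ G) ≐ shX H
  X⊛≐shX {G} p zero    k = X⊛-0 G k
  X⊛≐shX {G} p (suc n) k = trans (X⊛-suc G n k) (p n k)

  Rv⊛≐shR : ∀ {G H} → G ≐ H → (Rv ⊛ G) ≐ shR H
  Rv⊛≐shR {G} p n zero    = Rv⊛-0 G n
  Rv⊛≐shR {G} p n (suc k) = trans (Rv⊛-suc G n k) (p n k)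

  scalar⊛≐scale : ∀ c {G H} → G ≐ H → (scalar c ⊛ G) ≐ scale c H
  scalar⊛≐scale c {G} p n k = trans (scalar-⊛ c G n k) (cong (c *_) (p n k))

  -- narOp in coefficient form:  narOp′ Z = x Z' + Z + narOpRest Z, where
  -- narOpRest collects the terms of x-degree ≥ 2 in front of Z' and ≥ 1 in front of Z
  narOpRest : Ser → Ser
  narOpRest Z = scale (+ 2) (shR (shX (shX (∂ Z)))) ⊕ ⊝ scale (+ 2) (shX (shX (∂ Z))) ⊕ shR (shR (shX (shX (shX (∂ Z)))))
              ⊕ scale (+ 2) (shR (shX (shX (shX (∂ Z))))) ⊕ shX (shX (shX (∂ Z))) ⊕ shR (shX Z) ⊕ ⊝ shX Z

  narOp′ : Ser → Ser
  narOp′ Z = (shX (∂ Z) ⊕ Z) ⊕ narOpRest Z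

  narOp≐narOp′ : ∀ Z → narOp Z ≐ narOp′ Z
  narOp≐narOp′ Z = begin
    narOp Z
      ≈⟨ solve 4 (λ r x d z' → x :* (con (+ 1) :+ con (+ 2) :* (r :- con (+ 1)) :* x :+ (r :+ con (+ 1)) :* (r :+ con (+ 1)) :* x :* x) :* d :+ (con (+ 1) :+ (r :- con (+ 1)) :* x) :* z'
           := (x :* d :+ z') :+ (con (+ 2) :* (r :* (x :* (x :* d))) :- con (+ 2) :* (x :* (x :* d)) :+ r :* (r :* (x :* (x :* (x :* d))))
                :+ con (+ 2) :* (r :* (x :* (x :* (x :* d)))) :+ x :* (x :* (x :* d)) :+ r :* (x :* z') :- x :* z'))
           ≐-refl Rv X (∂ Z) Z ⟩
    (X ⊛ D ⊕ Z) ⊕ (two ⊛ (Rv ⊛ (X ⊛ (X ⊛ D))) ⊕ ⊝ (two ⊛ (X ⊛ (X ⊛ D))) ⊕ Rv ⊛ (Rv ⊛ (X ⊛ (X ⊛ (X ⊛ D))))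
       ⊕ two ⊛ (Rv ⊛ (X ⊛ (X ⊛ (X ⊛ D)))) ⊕ X ⊛ (X ⊛ (X ⊛ D)) ⊕ Rv ⊛ (X ⊛ Z) ⊕ ⊝ (X ⊛ Z))
      ≈⟨ ⊕c (⊕-r Z x)
            (⊕c (⊕c (⊕c (⊕c (⊕c (⊕c (scalar⊛≐scale (+ 2) (Rv⊛≐shR xx)) (⊝c (scalar⊛≐scale (+ 2) xx)))
                 (Rv⊛≐shR (Rv⊛≐shR xxx))) (scalar⊛≐scale (+ 2) (Rv⊛≐shR xxx))) xxx)
                 (Rv⊛≐shR (X⊛≐shX ≐-refl))) (⊝c (X⊛≐shX ≐-refl))) ⟩
    narOp′ Z ∎
    where
    open ≐-Reasoning
    D : Ser
    D = ∂ Z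
    x : (X ⊛ D) ≐ shX D
    x = X⊛≐shX ≐-refl
    xx : (X ⊛ (X ⊛ D)) ≐ shX (shX D)
    xx = X⊛≐shX x
    xxx : (X ⊛ (X ⊛ (X ⊛ D))) ≐ shX (shX (shX D))
    xxx = X⊛≐shX xx

  narRhs′ : Ser
  narRhs′ = oneS ⊕ shR (shX oneS) ⊕ shX oneS

  narRhs≐narRhs′ : narRhs ≐ narRhs′
  narRhs≐narRhs′ = ≐-trans (solve 2 (λ r x → con (+ 1) :+ (r :+ con (+ 1)) :* x := con (+ 1) :+ r :* (x :* con (+ 1)) :+ x :* con (+ 1)) ≐-refl Rv X)
     (⊕c (⊕-l oneS (Rv⊛≐shR (X⊛≐shX ≐-refl))) (X⊛≐shX ≐-refl))


-- The Narayana numbers nar a b = C(a+1,b+1) C(a+1,b) / (a+1) (= N(a+1,b+1)).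
-- The division is exact: C(a+1,b+1) C(a+1,b) = (a+1) (C(a+1,b+1) C(a,b+1) - C(a+1,b+2) C(a,b)).
-- Neighbouring entries are related by the ratio identities 'nar-colStep'
-- and 'nar-rowStep'; combining them gives the four-term recurrence
-- 'nar-recurrence', which is exactly the coefficient identity saying that
-- the signed Narayana series solves narOp Z = 1 + (r+1)x.
module NarayanaNumbers where
  open import Data.Nat
  open import Data.Nat.Properties
  open import Data.Nat.Combinatorics using (_C_)
  open import Data.Nat.DivMod using (_/_; m*n/n≡m)
  open import Data.Sum using (inj₁; inj₂)
  open import Relation.Binary.PropositionalEquality
  open import Data.Nat.Solver
  open +-*-Solver using (solve; _:+_; _:*_; _:=_; con)
  open import Data.Nat.Tactic.RingSolver using (solve-∀)
  open Binomial

  -- kept abstract so that the division is never unfolded during type checking;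
  -- all computation goes through 'nar-mul'
  abstract
    nar : ℕ → ℕ → ℕ
    nar a b = ((suc a C suc b) * (suc a C b)) / suc a

    nar-unfold : ∀ a b → nar a b ≡ ((suc a C suc b) * (suc a C b)) / suc a
    nar-unfold a b = refl

  narProd : ℕ → ℕ → ℕ
  narProd a b = bin (suc a) (suc b) * bin (suc a) b

  -- the exact quotient narProd a b / (a+1), written without division
  narDiff : ℕ → ℕ → ℕ
  narDiff a zero = 1
  narDiff a (suc b) = bin (suc a) (suc b) * bin a (suc b) ∸ bin (suc a) (suc (suc b)) * bin a b

  narProd≡ : ∀ a b → narProd a b ≡ narDiff a b * suc a
  narProd≡ a zero = trans (cong (_* 1) (bin-1 (suc a))) (trans (*-identityʳ (suc a)) (sym (+-identityʳ (suc a))))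
  narProd≡ a (suc b) = sym (begin
    (Xv ∸ Yv) * suc a ≡⟨ *-distribʳ-∸ (suc a) Xv Yv ⟩
    Xv * suc a ∸ Yv * suc a ≡⟨ cong₂ _∸_ eX eY ⟩
    suc (suc b) * P ∸ suc b * P ≡⟨ cong (_∸ suc b * P) (solve 2 (λ b p → (con 2 :+ b) :* p := p :+ (con 1 :+ b) :* p) refl b P) ⟩
    P + suc b * P ∸ suc b * P ≡⟨ m+n∸n≡m P (suc b * P) ⟩
    P ∎)
    where
    open ≡-Reasoning
    P Xv Yv : ℕ
    P = narProd a (suc b)
    Xv = bin (suc a) (suc b) * bin a (suc b)
    Yv = bin (suc a) (suc (suc b)) * bin a b
    eX : Xv * suc a ≡ suc (suc b) * P
    eX = begin
      bin (suc a) (suc b) * bin a (suc b) * suc a ≡⟨ solve 3 (λ x y a → x :* y :* (con 1 :+ a) := x :* ((con 1 :+ a) :* y)) refl (bin (suc a) (suc b)) (bin a (suc b)) a ⟩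
      bin (suc a) (suc b) * (suc a * bin a (suc b)) ≡⟨ cong (bin (suc a) (suc b) *_) (sym (absorb a (suc b))) ⟩
      bin (suc a) (suc b) * (suc (suc b) * bin (suc a) (suc (suc b))) ≡⟨ solve 3 (λ x y b → x :* ((con 2 :+ b) :* y) := (con 2 :+ b) :* (y :* x)) refl (bin (suc a) (suc b)) (bin (suc a) (suc (suc b))) b ⟩
      suc (suc b) * P ∎
    eY : Yv * suc a ≡ suc b * P
    eY = begin
      bin (suc a) (suc (suc b)) * bin a b * suc a ≡⟨ solve 3 (λ x y a → x :* y :* (con 1 :+ a) := x :* ((con 1 :+ a) :* y)) refl (bin (suc a) (suc (suc b))) (bin a b) a ⟩
      bin (suc a) (suc (suc b)) * (suc a * bin a b) ≡⟨ cong (bin (suc a) (suc (suc b)) *_) (sym (absorb a b)) ⟩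
      bin (suc a) (suc (suc b)) * (suc b * bin (suc a) (suc b)) ≡⟨ solve 3 (λ x y b → x :* ((con 1 :+ b) :* y) := (con 1 :+ b) :* (x :* y)) refl (bin (suc a) (suc (suc b))) (bin (suc a) (suc b)) b ⟩
      suc b * P ∎

  nar≡narDiff : ∀ a b → nar a b ≡ narDiff a b
  nar≡narDiff a b = begin
    nar a b ≡⟨ nar-unfold a b ⟩
    ((suc a C suc b) * (suc a C b)) / suc a ≡⟨ cong (_/ suc a) (sym (cong₂ _*_ (bin≡C (suc a) (suc b)) (bin≡C (suc a) b))) ⟩
    narProd a b / suc a ≡⟨ cong (_/ suc a) (narProd≡ a b) ⟩
    (narDiff a b * suc a) / suc a ≡⟨ m*n/n≡m (narDiff a b) (suc a) ⟩
    narDiff a b ∎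
    where open ≡-Reasoning

  nar-mul : ∀ a b → nar a b * suc a ≡ narProd a b
  nar-mul a b = trans (cong (_* suc a) (nar≡narDiff a b)) (sym (narProd≡ a b))

  nar-0 : ∀ a → nar a 0 ≡ 1
  nar-0 a = nar≡narDiff a 0

  nar-vanish : ∀ a b → a < b → nar a b ≡ 0
  nar-vanish a b a<b = *-cancelʳ-≡ _ _ (suc a) (trans (nar-mul a b) (cong (_* bin (suc a) b) (bin-zero (suc a) (suc b) (s≤s a<b))))

  nar-diag : ∀ a → nar a a ≡ 1
  nar-diag a = *-cancelʳ-≡ _ _ (suc a) (trans (nar-mul a a) (cong₂ _*_ (bin-nn (suc a)) (bin-sn a)))

  bin-down : ∀ m k → suc k * bin m (suc k) ≡ (m ∸ k) * bin m k
  bin-down m k = begin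
    suc k * bin m (suc k) ≡⟨ sym (m+n∸n≡m _ (k * bin m k)) ⟩
    suc k * bin m (suc k) + k * bin m k ∸ k * bin m k ≡⟨ cong (_∸ k * bin m k) (bin-step m k) ⟩
    m * bin m k ∸ k * bin m k ≡⟨ sym (*-distribʳ-∸ (bin m k) m k) ⟩
    (m ∸ k) * bin m k ∎
    where open ≡-Reasoning

  bin-up : ∀ m k → (suc m ∸ k) * bin (suc m) k ≡ suc m * bin m k
  bin-up m k = trans (sym (bin-down (suc m) k)) (absorb m k)

  nar-colStep : ∀ a b → suc b * suc (suc b) * nar a (suc b) ≡ (suc a ∸ b) * (a ∸ b) * nar a b
  nar-colStep a b = *-cancelʳ-≡ _ _ (suc a) (begin
    suc b * suc (suc b) * nar a (suc b) * suc a ≡⟨ solve 3 (λ b x y → (con 1 :+ b) :* (con 2 :+ b) :* x :* y := (con 1 :+ b) :* (con 2 :+ b) :* (x :* y)) refl b (nar a (suc b)) (suc a) ⟩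
    suc b * suc (suc b) * (nar a (suc b) * suc a) ≡⟨ cong (suc b * suc (suc b) *_) (nar-mul a (suc b)) ⟩
    suc b * suc (suc b) * (bin (suc a) (suc (suc b)) * bin (suc a) (suc b))
      ≡⟨ solve 4 (λ b x y z → (con 1 :+ b) :* (con 2 :+ b) :* (x :* y) := ((con 2 :+ b) :* x) :* ((con 1 :+ b) :* y)) refl b (bin (suc a) (suc (suc b))) (bin (suc a) (suc b)) a ⟩
    (suc (suc b) * bin (suc a) (suc (suc b))) * (suc b * bin (suc a) (suc b)) ≡⟨ cong₂ _*_ (bin-down (suc a) (suc b)) (bin-down (suc a) b) ⟩
    ((a ∸ b) * bin (suc a) (suc b)) * ((suc a ∸ b) * bin (suc a) b)
      ≡⟨ solve 4 (λ u v x y → (u :* x) :* (v :* y) := v :* u :* (x :* y)) refl (a ∸ b) (suc a ∸ b) (bin (suc a) (suc b)) (bin (suc a) b) ⟩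
    (suc a ∸ b) * (a ∸ b) * narProd a b ≡⟨ cong ((suc a ∸ b) * (a ∸ b) *_) (sym (nar-mul a b)) ⟩
    (suc a ∸ b) * (a ∸ b) * (nar a b * suc a) ≡⟨ solve 4 (λ u v x y → u :* v :* (x :* y) := u :* v :* x :* y) refl (suc a ∸ b) (a ∸ b) (nar a b) (suc a) ⟩
    (suc a ∸ b) * (a ∸ b) * nar a b * suc a ∎)
    where open ≡-Reasoning

  nar-rowStep : ∀ a b → (suc (suc a) ∸ b) * (suc a ∸ b) * nar (suc a) b ≡ suc a * suc (suc a) * nar a b
  nar-rowStep a b = *-cancelʳ-≡ _ _ (suc (suc a)) (begin
    u * v * nar (suc a) b * suc (suc a) ≡⟨ solve 4 (λ u v x y → u :* v :* x :* y := u :* v :* (x :* y)) refl u v (nar (suc a) b) (suc (suc a)) ⟩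
    u * v * (nar (suc a) b * suc (suc a)) ≡⟨ cong (u * v *_) (nar-mul (suc a) b) ⟩
    u * v * (bin (suc (suc a)) (suc b) * bin (suc (suc a)) b)
      ≡⟨ solve 4 (λ u v x y → u :* v :* (x :* y) := (v :* x) :* (u :* y)) refl u v (bin (suc (suc a)) (suc b)) (bin (suc (suc a)) b) ⟩
    (v * bin (suc (suc a)) (suc b)) * (u * bin (suc (suc a)) b) ≡⟨ cong₂ _*_ (bin-up (suc a) (suc b)) (bin-up (suc a) b) ⟩
    (suc (suc a) * bin (suc a) (suc b)) * (suc (suc a) * bin (suc a) b)
      ≡⟨ solve 3 (λ a x y → ((con 2 :+ a) :* x) :* ((con 2 :+ a) :* y) := (con 2 :+ a) :* (con 2 :+ a) :* (x :* y)) refl a (bin (suc a) (suc b)) (bin (suc a) b) ⟩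
    suc (suc a) * suc (suc a) * narProd a b ≡⟨ cong (suc (suc a) * suc (suc a) *_) (sym (nar-mul a b)) ⟩
    suc (suc a) * suc (suc a) * (nar a b * suc a)
      ≡⟨ solve 2 (λ a x → (con 2 :+ a) :* (con 2 :+ a) :* (x :* (con 1 :+ a)) := (con 1 :+ a) :* (con 2 :+ a) :* x :* (con 2 :+ a)) refl a (nar a b) ⟩
    suc a * suc (suc a) * nar a b * suc (suc a) ∎)
    where
    open ≡-Reasoning
    u v : ℕ
    u = suc (suc a) ∸ b
    v = suc a ∸ b

  nar-1 : ∀ a → 2 * nar a 1 ≡ suc a * a
  nar-1 a = trans (nar-colStep a 0) (trans (cong ((suc a) * a *_) (nar-0 a)) (*-identityʳ _))

  -- the common factor cleared when all terms of the recurrence are expressed via N(l,i)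
  Φ : ℕ → ℕ
  Φ i = suc i * suc (suc i) * suc (suc i) * suc (suc (suc i))

  cancelΦ : ∀ i x y → Φ i * x ≡ Φ i * y → x ≡ y
  cancelΦ i x y = *-cancelˡ-≡ x y (Φ i)

  NarRecShape : ℕ → ℕ → ℕ → ℕ → ℕ → ℕ → ℕ → Set
  NarRecShape l A B0 B2 C1 C2 B1 = (4 + l) * A + (1 + l) * (B0 + B2) ≡ (5 + 2 * l) * (C1 + C2) + 2 * (1 + l) * B1

  NarRec : ℕ → ℕ → Set
  NarRec l i = NarRecShape l (nar (2 + l) (2 + i)) (nar l i) (nar l (2 + i)) (nar (1 + l) (1 + i)) (nar (1 + l) (2 + i)) (nar l (1 + i))

  NarRecShape-subst : ∀ l {A A' B0 B0' B2 B2' C1 C1' C2 C2' B1 B1'} → A ≡ A' → B0 ≡ B0' → B2 ≡ B2' → C1 ≡ C1' → C2 ≡ C2' → B1 ≡ B1' →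
            NarRecShape l A' B0' B2' C1' C2' B1' → NarRecShape l A B0 B2 C1 C2 B1
  NarRecShape-subst l refl refl refl refl refl refl p = p

  -- on and beyond the diagonal the entries are 0 or 1
  narRec-diag : ∀ i → NarRec i i
  narRec-diag i = NarRecShape-subst i (nar-diag (2 + i)) (nar-diag i) (nar-vanish i (2 + i) (m≤n⇒m≤1+n (n<1+n i)))
                        (nar-diag (1 + i)) (nar-vanish (1 + i) (2 + i) (n<1+n (suc i))) (nar-vanish i (1 + i) (n<1+n i))
    (solve 1 (λ i → (con 4 :+ i) :* con 1 :+ (con 1 :+ i) :* (con 1 :+ con 0) := (con 5 :+ con 2 :* i) :* (con 1 :+ con 0) :+ con 2 :* (con 1 :+ i) :* con 0) refl i)

  narRec-far : ∀ l i → l < i → NarRec l i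
  narRec-far l i l<i = NarRecShape-subst l (nar-vanish (2 + l) (2 + i) (s≤s (s≤s l<i))) (nar-vanish l i l<i) (nar-vanish l (2 + i) (≤-trans l<i (m≤n⇒m≤1+n (n≤1+n i))))
                        (nar-vanish (1 + l) (1 + i) (s≤s l<i)) (nar-vanish (1 + l) (2 + i) (s≤s (m≤n⇒m≤1+n l<i))) (nar-vanish l (1 + i) (m≤n⇒m≤1+n l<i))
    (solve 1 (λ l → (con 4 :+ l) :* con 0 :+ (con 1 :+ l) :* (con 0 :+ con 0) := (con 5 :+ con 2 :* l) :* (con 0 :+ con 0) :+ con 2 :* (con 1 :+ l) :* con 0) refl l)

  Φ-split₁ : ∀ i x → (1 + i) * (2 + i) * (2 + i) * (3 + i) * x ≡ (2 + i) * (3 + i) * ((1 + i) * (2 + i) * x)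
  Φ-split₁ = solve-∀

  Φ-split₂ : ∀ i x → (1 + i) * (2 + i) * (2 + i) * (3 + i) * x ≡ (1 + i) * (2 + i) * ((2 + i) * (3 + i) * x)
  Φ-split₂ = solve-∀

  swap-pairs : ∀ a b c e x → a * b * (c * e * x) ≡ c * e * (a * b * x)
  swap-pairs = solve-∀

  flatten : ∀ a b c e x → a * b * (c * e * x) ≡ a * b * c * e * x
  flatten = solve-∀

  distribˡ-sides : ∀ f p q a b c → f * (p * a + q * (b + c)) ≡ p * (f * a) + q * (f * b + f * c)
  distribˡ-sides = solve-∀

  distribʳ-sides : ∀ f p q a b c → f * (p * (a + b) + q * c) ≡ p * (f * a + f * b) + q * (f * c)
  distribʳ-sides = solve-∀

  -- the recurrence once every term is written as a multiple of N(l,i), with l = d + i + 1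
  recurrence-in-B0 : ∀ d i b →
      (5 + d + i) * ((3 + d + i) * (4 + d + i) * (2 + d + i) * (3 + d + i) * b)
        + (2 + d + i) * ((1 + i) * (2 + i) * (2 + i) * (3 + i) * b + (1 + d) * d * (2 + d) * (1 + d) * b)
    ≡ (5 + 2 * (1 + d + i)) * ((2 + i) * (3 + i) * (2 + d + i) * (3 + d + i) * b + (2 + d) * (1 + d) * (2 + d + i) * (3 + d + i) * b)
        + 2 * (2 + d + i) * ((2 + i) * (3 + i) * (2 + d) * (1 + d) * b)
  recurrence-in-B0 = solve-∀

  -- strictly below the diagonal (l = i + d + 1): express every term as a
  -- multiple of B0 = N(l,i) using the ratio identities, after clearing Φ i
  module NarRecInterior (d i : ℕ) where
    l B0 B1 B2 C0 C1 C2 A0 A1 A : ℕ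
    l = suc (d + i)
    B0 = nar l i
    B1 = nar l (1 + i)
    B2 = nar l (2 + i)
    C0 = nar (1 + l) i
    C1 = nar (1 + l) (1 + i)
    C2 = nar (1 + l) (2 + i)
    A0 = nar (2 + l) i
    A1 = nar (2 + l) (1 + i)
    A = nar (2 + l) (2 + i)

    ∸i : ∀ c → (c + i) ∸ i ≡ c
    ∸i c = m+n∸n≡m c i

    factors-cong : ∀ {u v u' v'} x → u ≡ u' → v ≡ v' → u * v * x ≡ u' * v' * x
    factors-cong x p q = cong₂ (λ a b → a * b * x) p q

    B1~B0 : suc i * suc (suc i) * B1 ≡ suc (suc d) * suc d * B0
    B1~B0 = trans (nar-colStep l i) (factors-cong B0 (∸i (suc (suc d))) (∸i (suc d)))
    B2~B1 : suc (suc i) * suc (suc (suc i)) * B2 ≡ suc d * d * B1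
    B2~B1 = trans (nar-colStep l (suc i)) (factors-cong B1 (∸i (suc d)) (∸i d))
    C0~B0 : suc (suc (suc d)) * suc (suc d) * C0 ≡ suc l * suc (suc l) * B0
    C0~B0 = trans (factors-cong C0 (sym (∸i (suc (suc (suc d))))) (sym (∸i (suc (suc d))))) (nar-rowStep l i)
    C1~C0 : suc i * suc (suc i) * C1 ≡ suc (suc (suc d)) * suc (suc d) * C0
    C1~C0 = trans (nar-colStep (suc l) i) (factors-cong C0 (∸i (suc (suc (suc d)))) (∸i (suc (suc d))))
    C2~C1 : suc (suc i) * suc (suc (suc i)) * C2 ≡ suc (suc d) * suc d * C1
    C2~C1 = trans (nar-colStep (suc l) (suc i)) (factors-cong C1 (∸i (suc (suc d))) (∸i (suc d)))
    A0~C0 : suc (suc (suc (suc d))) * suc (suc (suc d)) * A0 ≡ suc (suc l) * suc (suc (suc l)) * C0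
    A0~C0 = trans (factors-cong A0 (sym (∸i (suc (suc (suc (suc d)))))) (sym (∸i (suc (suc (suc d)))))) (nar-rowStep (suc l) i)
    A1~A0 : suc i * suc (suc i) * A1 ≡ suc (suc (suc (suc d))) * suc (suc (suc d)) * A0
    A1~A0 = trans (nar-colStep (suc (suc l)) i) (factors-cong A0 (∸i (suc (suc (suc (suc d))))) (∸i (suc (suc (suc d)))))
    A~A1 : suc (suc i) * suc (suc (suc i)) * A ≡ suc (suc (suc d)) * suc (suc d) * A1
    A~A1 = trans (nar-colStep (suc (suc l)) (suc i)) (factors-cong A1 (∸i (suc (suc (suc d)))) (∸i (suc (suc d))))

    ΦB1 : Φ i * B1 ≡ (2 + i) * (3 + i) * (2 + d) * (1 + d) * B0
    ΦB1 = begin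
      Φ i * B1                                         ≡⟨ Φ-split₁ i B1 ⟩
      (2 + i) * (3 + i) * ((1 + i) * (2 + i) * B1)     ≡⟨ cong ((2 + i) * (3 + i) *_) B1~B0 ⟩
      (2 + i) * (3 + i) * ((2 + d) * (1 + d) * B0)     ≡⟨ flatten (2 + i) (3 + i) (2 + d) (1 + d) B0 ⟩
      (2 + i) * (3 + i) * (2 + d) * (1 + d) * B0       ∎
      where open ≡-Reasoning

    ΦB2 : Φ i * B2 ≡ (1 + d) * d * (2 + d) * (1 + d) * B0
    ΦB2 = begin
      Φ i * B2                                         ≡⟨ Φ-split₂ i B2 ⟩
      (1 + i) * (2 + i) * ((2 + i) * (3 + i) * B2)     ≡⟨ cong ((1 + i) * (2 + i) *_) B2~B1 ⟩
      (1 + i) * (2 + i) * ((1 + d) * d * B1)           ≡⟨ swap-pairs (1 + i) (2 + i) (1 + d) d B1 ⟩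
      (1 + d) * d * ((1 + i) * (2 + i) * B1)           ≡⟨ cong ((1 + d) * d *_) B1~B0 ⟩
      (1 + d) * d * ((2 + d) * (1 + d) * B0)           ≡⟨ flatten (1 + d) d (2 + d) (1 + d) B0 ⟩
      (1 + d) * d * (2 + d) * (1 + d) * B0             ∎
      where open ≡-Reasoning

    ΦC1 : Φ i * C1 ≡ (2 + i) * (3 + i) * (1 + l) * (2 + l) * B0
    ΦC1 = begin
      Φ i * C1                                         ≡⟨ Φ-split₁ i C1 ⟩
      (2 + i) * (3 + i) * ((1 + i) * (2 + i) * C1)     ≡⟨ cong ((2 + i) * (3 + i) *_) (trans C1~C0 C0~B0) ⟩
      (2 + i) * (3 + i) * ((1 + l) * (2 + l) * B0)     ≡⟨ flatten (2 + i) (3 + i) (1 + l) (2 + l) B0 ⟩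
      (2 + i) * (3 + i) * (1 + l) * (2 + l) * B0       ∎
      where open ≡-Reasoning

    ΦC2 : Φ i * C2 ≡ (2 + d) * (1 + d) * (1 + l) * (2 + l) * B0
    ΦC2 = begin
      Φ i * C2                                         ≡⟨ Φ-split₂ i C2 ⟩
      (1 + i) * (2 + i) * ((2 + i) * (3 + i) * C2)     ≡⟨ cong ((1 + i) * (2 + i) *_) C2~C1 ⟩
      (1 + i) * (2 + i) * ((2 + d) * (1 + d) * C1)     ≡⟨ swap-pairs (1 + i) (2 + i) (2 + d) (1 + d) C1 ⟩
      (2 + d) * (1 + d) * ((1 + i) * (2 + i) * C1)     ≡⟨ cong ((2 + d) * (1 + d) *_) (trans C1~C0 C0~B0) ⟩
      (2 + d) * (1 + d) * ((1 + l) * (2 + l) * B0)     ≡⟨ flatten (2 + d) (1 + d) (1 + l) (2 + l) B0 ⟩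
      (2 + d) * (1 + d) * (1 + l) * (2 + l) * B0       ∎
      where open ≡-Reasoning

    ΦA : Φ i * A ≡ (2 + l) * (3 + l) * (1 + l) * (2 + l) * B0
    ΦA = begin
      Φ i * A                                          ≡⟨ Φ-split₂ i A ⟩
      (1 + i) * (2 + i) * ((2 + i) * (3 + i) * A)      ≡⟨ cong ((1 + i) * (2 + i) *_) A~A1 ⟩
      (1 + i) * (2 + i) * ((3 + d) * (2 + d) * A1)     ≡⟨ swap-pairs (1 + i) (2 + i) (3 + d) (2 + d) A1 ⟩
      (3 + d) * (2 + d) * ((1 + i) * (2 + i) * A1)     ≡⟨ cong ((3 + d) * (2 + d) *_) (trans A1~A0 A0~C0) ⟩
      (3 + d) * (2 + d) * ((2 + l) * (3 + l) * C0)     ≡⟨ swap-pairs (3 + d) (2 + d) (2 + l) (3 + l) C0 ⟩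
      (2 + l) * (3 + l) * ((3 + d) * (2 + d) * C0)     ≡⟨ cong ((2 + l) * (3 + l) *_) C0~B0 ⟩
      (2 + l) * (3 + l) * ((1 + l) * (2 + l) * B0)     ≡⟨ flatten (2 + l) (3 + l) (1 + l) (2 + l) B0 ⟩
      (2 + l) * (3 + l) * (1 + l) * (2 + l) * B0       ∎
      where open ≡-Reasoning

    Φrecurrence : Φ i * ((4 + l) * A + (1 + l) * (B0 + B2)) ≡ Φ i * ((5 + 2 * l) * (C1 + C2) + 2 * (1 + l) * B1)
    Φrecurrence = begin
      Φ i * ((4 + l) * A + (1 + l) * (B0 + B2))
        ≡⟨ distribˡ-sides (Φ i) (4 + l) (1 + l) A B0 B2 ⟩
      (4 + l) * (Φ i * A) + (1 + l) * (Φ i * B0 + Φ i * B2)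
        ≡⟨ cong₂ (λ x y → (4 + l) * x + (1 + l) * (Φ i * B0 + y)) ΦA ΦB2 ⟩
      (4 + l) * ((2 + l) * (3 + l) * (1 + l) * (2 + l) * B0) + (1 + l) * (Φ i * B0 + (1 + d) * d * (2 + d) * (1 + d) * B0)
        ≡⟨ recurrence-in-B0 d i B0 ⟩
      (5 + 2 * l) * ((2 + i) * (3 + i) * (1 + l) * (2 + l) * B0 + (2 + d) * (1 + d) * (1 + l) * (2 + l) * B0)
        + 2 * (1 + l) * ((2 + i) * (3 + i) * (2 + d) * (1 + d) * B0)
        ≡⟨ sym (cong₂ (λ x y → (5 + 2 * l) * x + 2 * (1 + l) * y) (cong₂ _+_ ΦC1 ΦC2) ΦB1) ⟩
      (5 + 2 * l) * (Φ i * C1 + Φ i * C2) + 2 * (1 + l) * (Φ i * B1)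
        ≡⟨ sym (distribʳ-sides (Φ i) (5 + 2 * l) (2 * (1 + l)) C1 C2 B1) ⟩
      Φ i * ((5 + 2 * l) * (C1 + C2) + 2 * (1 + l) * B1) ∎
      where open ≡-Reasoning

    narRec-interior : NarRec l i
    narRec-interior = cancelΦ i _ _ Φrecurrence

  nar-recurrence : ∀ l i → NarRec l i
  nar-recurrence l i with ≤-<-connex i l
  ... | inj₂ l<i = narRec-far l i l<i
  ... | inj₁ i≤l = subst (λ t → NarRec t i) (m∸n+n≡m i≤l) (byDistance (l ∸ i))
    where
    byDistance : ∀ e → NarRec (e + i) i
    byDistance zero    = narRec-diag i
    byDistance (suc d) = NarRecInterior.narRec-interior d i


-- Solutions of narOp Z = F are unique: in coefficient form, row n of narOp′ Z
-- is (n+1) Z_n plus terms involving only the rows < n of Z, so a solution of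
-- the homogeneous equation vanishes row by row.
module NarOpUniqueness where
  open import Data.Integer as ℤ using (+_; -_; _+_; _*_)
  import Data.Integer.Properties as ℤP
  open PE using (refl; cong; cong₂; sym; trans)
  open Bivariate
  open SeriesBasics
  open Derivative
  open NarayanaODE
  open import Data.Integer.Tactic.RingSolver using (solve-∀)

  record RowZero (G : Ser) (n : ℕ) : Set where
    constructor rowZero
    field at : ∀ k → G n k ≡ + 0
  open RowZero

  rowZero-shR : ∀ {G n} → RowZero G n → RowZero (shR G) n
  rowZero-shR p = rowZero λ { zero → refl ; (suc k) → at p k }

  rowZero-scale : ∀ c {G n} → RowZero G n → RowZero (scale c G) n
  rowZero-scale c p = rowZero λ k → trans (cong (c *_) (at p k)) (ℤP.*-zeroʳ c)

  rowZero-⊝ : ∀ {G n} → RowZero G n → RowZero (⊝ G) n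
  rowZero-⊝ p = rowZero λ k → cong -_ (at p k)

  rowZero-⊕ : ∀ {G H n} → RowZero G n → RowZero H n → RowZero (G ⊕ H) n
  rowZero-⊕ p q = rowZero λ k → cong₂ _+_ (at p k) (at q k)

  module _ (Z : Ser) where
    module _ (n : ℕ) (below : ∀ i → i < n → RowZero Z i) where
      rowZero-x∂ : ∀ j → j < n → RowZero (shX (∂ Z)) j
      rowZero-x∂ zero    _   = rowZero λ k → refl
      rowZero-x∂ (suc j) j<n = rowZero λ k → trans (cong (+ suc j *_) (at (below (suc j) j<n) k)) (ℤP.*-zeroʳ (+ suc j))

      rowZero-x²∂ : ∀ j → j ≤ n → RowZero (shX (shX (∂ Z))) j
      rowZero-x²∂ zero    _   = rowZero λ k → refl
      rowZero-x²∂ (suc j) j≤n = rowZero (at (rowZero-x∂ j j≤n))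

      rowZero-x³∂ : ∀ j → j ≤ n → RowZero (shX (shX (shX (∂ Z)))) j
      rowZero-x³∂ zero    _   = rowZero λ k → refl
      rowZero-x³∂ (suc j) j≤n = rowZero (at (rowZero-x²∂ j (ℕP.<⇒≤ j≤n)))

      rowZero-x : ∀ j → j ≤ n → RowZero (shX Z) j
      rowZero-x zero    _   = rowZero λ k → refl
      rowZero-x (suc j) j≤n = rowZero (at (below j j≤n))

      narOpRest-rowZero : RowZero (narOpRest Z) n
      narOpRest-rowZero =
        rowZero-⊕ (rowZero-⊕ (rowZero-⊕ (rowZero-⊕ (rowZero-⊕ (rowZero-⊕
          (rowZero-scale (+ 2) (rowZero-shR (rowZero-x²∂ n ℕP.≤-refl)))
          (rowZero-⊝ (rowZero-scale (+ 2) (rowZero-x²∂ n ℕP.≤-refl))))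
          (rowZero-shR (rowZero-shR (rowZero-x³∂ n ℕP.≤-refl))))
          (rowZero-scale (+ 2) (rowZero-shR (rowZero-x³∂ n ℕP.≤-refl))))
          (rowZero-x³∂ n ℕP.≤-refl))
          (rowZero-shR (rowZero-x n ℕP.≤-refl)))
          (rowZero-⊝ (rowZero-x n ℕP.≤-refl))

    leading-term : ∀ n k → shX (∂ Z) n k + Z n k ≡ + suc n * Z n k
    leading-term zero    k = trans (ℤP.+-identityˡ (Z 0 k)) (sym (ℤP.*-identityˡ (Z 0 k)))
    leading-term (suc m) k = distrib-suc (+ m) (Z (suc m) k)
      where
      distrib-suc : ∀ mm z → (+ 1 + mm) * z + z ≡ (+ 2 + mm) * z
      distrib-suc = solve-∀

    narOp′-unique : narOp′ Z ≐ zeroS → Z ≐ zeroS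
    narOp′-unique h n k = at (rowsBelow (suc n) n (ℕP.n<1+n n)) k
      where
      rowsBelow : ∀ N i → i < N → RowZero Z i
      rowsBelow (suc N) i i<N = rowZero λ k → suc-cancel i (Z i k) (begin
        + suc i * Z i k                    ≡⟨ sym (leading-term i k) ⟩
        shX (∂ Z) i k + Z i k              ≡⟨ sym (ℤP.+-identityʳ _) ⟩
        (shX (∂ Z) i k + Z i k) + + 0      ≡⟨ cong (λ t → (shX (∂ Z) i k + Z i k) + t) (sym (at (narOpRest-rowZero i lower) k)) ⟩
        narOp′ Z i k                       ≡⟨ h i k ⟩
        + 0                                ∎)
        where
        open PE.≡-Reasoning
        lower : ∀ j → j < i → RowZero Z j
        lower j j<i = rowsBelow N j (ℕP.<-≤-trans j<i (ℕP.≤-pred i<N))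


-- The signed Narayana series solves narOp′ Z = narRhs′: rows 0, 1, 2 are
-- checked by computation against an explicit table, and in rows ≥ 3 the
-- coefficient identity is the Narayana recurrence (columns ≥ 2) or a direct
-- polynomial identity (columns 0 and 1).
module NarayanaSolution where
  open import Data.Integer as ℤ using (ℤ; +_; -_; _+_; _*_)
  import Data.Integer.Properties as ℤP
  open PE using (refl; cong; cong₂; sym; trans)
  open Bivariate
  open SeriesBasics
  open Derivative
  open QuadraticEquation using (quadratic)
  open NarayanaODE
  open NarOpUniqueness using (narOp′-unique)
  open NarayanaNumbers
  open SerSolver using (solve; _:-_; _:=_; con)
  open import Data.Integer.Tactic.RingSolver using (solve-∀)

  record AgreeUpTo (n : ℕ) (G H : Ser) : Set where
    constructor agree
    field agreeAt : ∀ i k → i ≤ n → G i k ≡ H i k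
  open AgreeUpTo

  agree-shX : ∀ {n G H} → AgreeUpTo n G H → AgreeUpTo (suc n) (shX G) (shX H)
  agree-shX p = agree λ { zero k _ → refl ; (suc i) k (s≤s i≤n) → agreeAt p i k i≤n }

  agree-shX-0 : ∀ {G H} → AgreeUpTo 0 (shX G) (shX H)
  agree-shX-0 = agree λ { zero k _ → refl }

  agree-∂ : ∀ {n G H} → AgreeUpTo (suc n) G H → AgreeUpTo n (∂ G) (∂ H)
  agree-∂ p = agree λ i k i≤n → cong (+ suc i *_) (agreeAt p (suc i) k (s≤s i≤n))

  agree-weaken : ∀ {n G H} → AgreeUpTo (suc n) G H → AgreeUpTo n G H
  agree-weaken p = agree λ i k i≤n → agreeAt p i k (ℕP.m≤n⇒m≤1+n i≤n)

  agree-shR : ∀ {n G H} → AgreeUpTo n G H → AgreeUpTo n (shR G) (shR H)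
  agree-shR p = agree λ { i zero _ → refl ; i (suc k) i≤n → agreeAt p i k i≤n }

  agree-scale : ∀ c {n G H} → AgreeUpTo n G H → AgreeUpTo n (scale c G) (scale c H)
  agree-scale c p = agree λ i k i≤n → cong (c *_) (agreeAt p i k i≤n)

  agree-⊝ : ∀ {n G H} → AgreeUpTo n G H → AgreeUpTo n (⊝ G) (⊝ H)
  agree-⊝ p = agree λ i k i≤n → cong -_ (agreeAt p i k i≤n)

  agree-⊕ : ∀ {n G H G' H'} → AgreeUpTo n G H → AgreeUpTo n G' H' → AgreeUpTo n (G ⊕ G') (H ⊕ H')
  agree-⊕ p q = agree λ i k i≤n → cong₂ _+_ (agreeAt p i k i≤n) (agreeAt q i k i≤n)

  agree-x∂ : ∀ n {Z Z'} → AgreeUpTo n Z Z' → AgreeUpTo n (shX (∂ Z)) (shX (∂ Z'))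
  agree-x∂ zero p = agree-shX-0
  agree-x∂ (suc m) p = agree-shX (agree-∂ p)

  agree-x²∂ : ∀ n {Z Z'} → AgreeUpTo n Z Z' → AgreeUpTo n (shX (shX (∂ Z))) (shX (shX (∂ Z')))
  agree-x²∂ zero p = agree-shX-0
  agree-x²∂ (suc m) p = agree-shX (agree-x∂ m (agree-weaken p))

  agree-x³∂ : ∀ n {Z Z'} → AgreeUpTo n Z Z' → AgreeUpTo n (shX (shX (shX (∂ Z)))) (shX (shX (shX (∂ Z'))))
  agree-x³∂ zero p = agree-shX-0
  agree-x³∂ (suc m) p = agree-shX (agree-x²∂ m (agree-weaken p))

  agree-x : ∀ n {Z Z'} → AgreeUpTo n Z Z' → AgreeUpTo n (shX Z) (shX Z')
  agree-x zero p = agree-shX-0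
  agree-x (suc m) p = agree-shX (agree-weaken p)

  narOp′-agree : ∀ n {Z Z'} → AgreeUpTo n Z Z' → ∀ k → narOp′ Z n k ≡ narOp′ Z' n k
  narOp′-agree n {Z} {Z'} p k = agreeAt (agree-⊕ (agree-⊕ (agree-x∂ n p) p) rest) n k ℕP.≤-refl
    where
    rest : AgreeUpTo n (narOpRest Z) (narOpRest Z')
    rest = agree-⊕ (agree-⊕ (agree-⊕ (agree-⊕ (agree-⊕ (agree-⊕
             (agree-scale (+ 2) (agree-shR (agree-x²∂ n p)))
             (agree-⊝ (agree-scale (+ 2) (agree-x²∂ n p))))
             (agree-shR (agree-shR (agree-x³∂ n p))))
             (agree-scale (+ 2) (agree-shR (agree-x³∂ n p))))
             (agree-x³∂ n p))
             (agree-shR (agree-x n p)))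
             (agree-⊝ (agree-x n p))

  -- the signed Narayana numbers (-1)^b N(a+1,b+1); narSeries has row 0 equal to 1
  -- and row a+1 equal to the signed Narayana numbers N(a+1, ·)
  narSigned : ℕ → ℕ → ℤ
  narSigned a b = sign b (+ nar a b)

  narSeries : Ser
  narSeries zero k = oneS zero k
  narSeries (suc a) b = narSigned a b

  sign-0 : ∀ j → sign j (+ 0) ≡ + 0
  sign-0 zero = refl
  sign-0 (suc j) = cong -_ (sign-0 j)

  sign-2 : ∀ j x → sign (suc (suc j)) x ≡ sign j x
  sign-2 j x = ℤP.neg-involutive (sign j x)

  sign-mul : ∀ j x → sign j x ≡ sign j (+ 1) * x
  sign-mul zero x = sym (ℤP.*-identityˡ x)
  sign-mul (suc j) x = trans (cong -_ (sign-mul j x)) (ℤP.neg-distribˡ-* (sign j (+ 1)) x)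

  narSeriesLow : Ser
  narSeriesLow zero k = oneS zero k
  narSeriesLow (suc zero) zero = + 1
  narSeriesLow (suc zero) (suc k) = + 0
  narSeriesLow (suc (suc zero)) zero = + 1
  narSeriesLow (suc (suc zero)) (suc zero) = - (+ 1)
  narSeriesLow (suc (suc zero)) (suc (suc k)) = + 0
  narSeriesLow (suc (suc (suc n))) k = + 0

  narSigned-vanish : ∀ a b → a < b → narSigned a b ≡ + 0
  narSigned-vanish a b a<b = trans (cong (λ t → sign b (+ t)) (nar-vanish a b a<b)) (sign-0 b)

  narSeries-agrees-low : AgreeUpTo 2 narSeries narSeriesLow
  narSeries-agrees-low = agree λ
    { zero k _ → refl
    ; (suc zero) zero _ → cong +_ (nar-0 0)
    ; (suc zero) (suc k) _ → narSigned-vanish 0 (suc k) (s≤s z≤n)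
    ; (suc (suc zero)) zero _ → cong +_ (nar-0 1)
    ; (suc (suc zero)) (suc zero) _ → cong (λ t → - (+ t)) (nar-diag 1)
    ; (suc (suc zero)) (suc (suc k)) _ → narSigned-vanish 1 (suc (suc k)) (s≤s (s≤s z≤n))
    ; (suc (suc (suc i))) k (s≤s (s≤s ())) }

  narSeriesLow-row0 : ∀ k → narOp′ narSeriesLow 0 k ≡ narRhs′ 0 k
  narSeriesLow-row0 zero = refl
  narSeriesLow-row0 (suc zero) = refl
  narSeriesLow-row0 (suc (suc k)) = refl

  narSeriesLow-row1 : ∀ k → narOp′ narSeriesLow 1 k ≡ narRhs′ 1 k
  narSeriesLow-row1 zero = refl
  narSeriesLow-row1 (suc zero) = refl
  narSeriesLow-row1 (suc (suc k)) = refl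

  narSeriesLow-row2 : ∀ k → narOp′ narSeriesLow 2 k ≡ narRhs′ 2 k
  narSeriesLow-row2 zero = refl
  narSeriesLow-row2 (suc zero) = refl
  narSeriesLow-row2 (suc (suc zero)) = refl
  narSeriesLow-row2 (suc (suc (suc k))) = refl

  narOp′Interior : ℕ → ℤ → ℤ → ℤ → ℤ → ℤ → ℤ → ℤ
  narOp′Interior m nA nC1 nC2 nB0 nB1 nB2 =
    (+ suc (suc (suc m)) * nA + nA) + ((((((+ 2 * (+ suc (suc m) * nC1) + - (+ 2 * (+ suc (suc m) * nC2))) + + suc m * nB0)
       + + 2 * (+ suc m * nB1)) + + suc m * nB2) + nC1) + - nC2)

  cong₆ : ∀ (f : ℤ → ℤ → ℤ → ℤ → ℤ → ℤ → ℤ) {a a' b b' c c' d d' e e' g g'} →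
          a ≡ a' → b ≡ b' → c ≡ c' → d ≡ d' → e ≡ e' → g ≡ g' → f a b c d e g ≡ f a' b' c' d' e' g'
  cong₆ f refl refl refl refl refl refl = refl

  -- with alternating signs s, -s, s, the interior row is s · (LHS - RHS) of the Narayana recurrence
  interior-identity : ∀ s mm a c1 c2 b0 b1 b2 →
      ((+ 3 + mm) * (s * a) + s * a) + ((((((+ 2 * ((+ 2 + mm) * - (s * c1)) + - (+ 2 * ((+ 2 + mm) * (s * c2))))
        + (+ 1 + mm) * (s * b0)) + + 2 * ((+ 1 + mm) * - (s * b1))) + (+ 1 + mm) * (s * b2)) + - (s * c1)) + - (s * c2))
    ≡ s * (((+ 4 + mm) * a + (+ 1 + mm) * (b0 + b2)) + - ((+ 5 + + 2 * mm) * (c1 + c2) + + 2 * (+ 1 + mm) * b1))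
  interior-identity = solve-∀

  recLHS-cast : ∀ m A B0 B2 → + ((4 ℕ.+ m) ℕ.* A ℕ.+ (1 ℕ.+ m) ℕ.* (B0 ℕ.+ B2)) ≡ (+ 4 + + m) * + A + (+ 1 + + m) * (+ B0 + + B2)
  recLHS-cast m A B0 B2 = trans (ℤP.pos-+ ((4 ℕ.+ m) ℕ.* A) _) (cong₂ _+_ (ℤP.pos-* (4 ℕ.+ m) A)
     (trans (ℤP.pos-* (1 ℕ.+ m) (B0 ℕ.+ B2)) (cong (+ (1 ℕ.+ m) *_) (ℤP.pos-+ B0 B2))))

  recRHS-cast : ∀ m C1 C2 B1 → + ((5 ℕ.+ 2 ℕ.* m) ℕ.* (C1 ℕ.+ C2) ℕ.+ 2 ℕ.* (1 ℕ.+ m) ℕ.* B1)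
                             ≡ (+ 5 + + 2 * + m) * (+ C1 + + C2) + + 2 * (+ 1 + + m) * + B1
  recRHS-cast m C1 C2 B1 = trans (ℤP.pos-+ ((5 ℕ.+ 2 ℕ.* m) ℕ.* (C1 ℕ.+ C2)) _) (cong₂ _+_
     (trans (ℤP.pos-* (5 ℕ.+ 2 ℕ.* m) (C1 ℕ.+ C2)) (cong₂ _*_ (trans (ℤP.pos-+ 5 (2 ℕ.* m)) (cong (λ t → + 5 + t) (ℤP.pos-* 2 m))) (ℤP.pos-+ C1 C2)))
     (trans (ℤP.pos-* (2 ℕ.* (1 ℕ.+ m)) B1) (cong (_* + B1) (ℤP.pos-* 2 (1 ℕ.+ m)))))

  narSeries-solves-interior : ∀ m j → narOp′ narSeries (3 ℕ.+ m) (2 ℕ.+ j) ≡ + 0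
  narSeries-solves-interior m j = begin
    narOp′Interior m (narSigned (2 ℕ.+ m) (2 ℕ.+ j)) (narSigned (1 ℕ.+ m) (1 ℕ.+ j)) (narSigned (1 ℕ.+ m) (2 ℕ.+ j))
                     (narSigned m j) (narSigned m (1 ℕ.+ j)) (narSigned m (2 ℕ.+ j))
      ≡⟨ cong₆ (narOp′Interior m) (sign-even A) (sign-odd C1) (sign-even C2) (sign-mul j (+ B0)) (sign-odd B1) (sign-even B2) ⟩
    narOp′Interior m (σ * + A) (- (σ * + C1)) (σ * + C2) (σ * + B0) (- (σ * + B1)) (σ * + B2)
      ≡⟨ interior-identity σ (+ m) (+ A) (+ C1) (+ C2) (+ B0) (+ B1) (+ B2) ⟩
    σ * (recLHS + - recRHS)   ≡⟨ cong (λ t → σ * (t + - recRHS)) recurrence ⟩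
    σ * (recRHS + - recRHS)   ≡⟨ cong (σ *_) (ℤP.+-inverseʳ recRHS) ⟩
    σ * + 0                   ≡⟨ ℤP.*-zeroʳ σ ⟩
    + 0                       ∎
    where
    open PE.≡-Reasoning
    σ : ℤ
    σ = sign j (+ 1)
    A C1 C2 B0 B1 B2 : ℕ
    A = nar (2 ℕ.+ m) (2 ℕ.+ j)
    C1 = nar (1 ℕ.+ m) (1 ℕ.+ j)
    C2 = nar (1 ℕ.+ m) (2 ℕ.+ j)
    B0 = nar m j
    B1 = nar m (1 ℕ.+ j)
    B2 = nar m (2 ℕ.+ j)
    sign-even : ∀ x → sign (2 ℕ.+ j) (+ x) ≡ σ * + x
    sign-even x = trans (sign-2 j (+ x)) (sign-mul j (+ x))
    sign-odd : ∀ x → sign (1 ℕ.+ j) (+ x) ≡ - (σ * + x)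
    sign-odd x = cong -_ (sign-mul j (+ x))
    recLHS recRHS : ℤ
    recLHS = (+ 4 + + m) * + A + (+ 1 + + m) * (+ B0 + + B2)
    recRHS = (+ 5 + + 2 * + m) * (+ C1 + + C2) + + 2 * (+ 1 + + m) * + B1
    recurrence : recLHS ≡ recRHS
    recurrence = trans (sym (recLHS-cast m A B0 B2)) (trans (cong +_ (nar-recurrence m j)) (recRHS-cast m C1 C2 B1))

  -- column 0: all entries are 1, and (m+4) - 2(m+2) + (m+1) - 1 = 0
  narOp′Col0 : ℕ → ℤ → ℤ → ℤ → ℤ
  narOp′Col0 m a c b = (+ suc (suc (suc m)) * a + a) + ((((((+ 2 * + 0 + - (+ 2 * (+ suc (suc m) * c))) + + 0) + + 2 * + 0) + + suc m * b) + + 0) + - c)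

  col0-identity : ∀ mm → ((+ 3 + mm) * + 1 + + 1) + ((((((+ 2 * + 0 + - (+ 2 * ((+ 2 + mm) * + 1))) + + 0) + + 2 * + 0)
                          + (+ 1 + mm) * + 1) + + 0) + - + 1) ≡ + 0
  col0-identity = solve-∀

  narSeries-solves-col0 : ∀ m → narOp′ narSeries (3 ℕ.+ m) 0 ≡ + 0
  narSeries-solves-col0 m = begin
    narOp′Col0 m (narSigned (2 ℕ.+ m) 0) (narSigned (1 ℕ.+ m) 0) (narSigned m 0)
      ≡⟨ cong (λ a → narOp′Col0 m a (narSigned (1 ℕ.+ m) 0) (narSigned m 0)) (cong +_ (nar-0 (2 ℕ.+ m))) ⟩
    narOp′Col0 m (+ 1) (narSigned (1 ℕ.+ m) 0) (narSigned m 0)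
      ≡⟨ cong₂ (narOp′Col0 m (+ 1)) (cong +_ (nar-0 (1 ℕ.+ m))) (cong +_ (nar-0 m)) ⟩
    narOp′Col0 m (+ 1) (+ 1) (+ 1)
      ≡⟨ col0-identity (+ m) ⟩
    + 0 ∎
    where open PE.≡-Reasoning

  -- column 1: entries 1 and -N(a+1,2) with 2 N(a+1,2) = (a+1) a
  narOp′Col1 : ℕ → ℤ → ℤ → ℤ → ℤ → ℤ → ℤ
  narOp′Col1 m a1 c0 c1 b0 b1 = (+ suc (suc (suc m)) * a1 + a1) + ((((((+ 2 * (+ suc (suc m) * c0) + - (+ 2 * (+ suc (suc m) * c1))) + + 0)
      + + 2 * (+ suc m * b0)) + + suc m * b1) + c0) + - c1)

  two·nar-1 : ∀ a → + 2 * + nar a 1 ≡ + suc a * + a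
  two·nar-1 a = trans (sym (ℤP.pos-* 2 (nar a 1))) (trans (cong +_ (nar-1 a)) (ℤP.pos-* (suc a) a))

  col1-expand : ∀ mm a b c → + 2 * (((+ 3 + mm) * - a + - a) + ((((((+ 2 * ((+ 2 + mm) * + 1) + - (+ 2 * ((+ 2 + mm) * - b))) + + 0)
                               + + 2 * ((+ 1 + mm) * + 1)) + (+ 1 + mm) * - c) + + 1) + - - b))
                ≡ - (+ 4 + mm) * (+ 2 * a) + (+ 5 + + 2 * mm) * (+ 2 * b) + - (+ 1 + mm) * (+ 2 * c) + (+ 14 + + 8 * mm)
  col1-expand = solve-∀

  col1-identity : ∀ mm → - (+ 4 + mm) * ((+ 3 + mm) * (+ 2 + mm)) + (+ 5 + + 2 * mm) * ((+ 2 + mm) * (+ 1 + mm))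
                         + - (+ 1 + mm) * ((+ 1 + mm) * mm) + (+ 14 + + 8 * mm) ≡ + 0
  col1-identity = solve-∀

  narSeries-solves-col1 : ∀ m → narOp′ narSeries (3 ℕ.+ m) 1 ≡ + 0
  narSeries-solves-col1 m = suc-cancel 1 _ (begin
    + 2 * narOp′Col1 m (- (+ x2)) (narSigned (1 ℕ.+ m) 0) (- (+ x1)) (narSigned m 0) (- (+ x0))
      ≡⟨ cong₂ (λ c b → + 2 * narOp′Col1 m (- (+ x2)) c (- (+ x1)) b (- (+ x0))) (cong +_ (nar-0 (1 ℕ.+ m))) (cong +_ (nar-0 m)) ⟩
    + 2 * narOp′Col1 m (- (+ x2)) (+ 1) (- (+ x1)) (+ 1) (- (+ x0))
      ≡⟨ col1-expand (+ m) (+ x2) (+ x1) (+ x0) ⟩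
    - (+ 4 + + m) * (+ 2 * + x2) + (+ 5 + + 2 * + m) * (+ 2 * + x1) + - (+ 1 + + m) * (+ 2 * + x0) + (+ 14 + + 8 * + m)
      ≡⟨ cong₃ (λ p q r → - (+ 4 + + m) * p + (+ 5 + + 2 * + m) * q + - (+ 1 + + m) * r + (+ 14 + + 8 * + m))
               (two·nar-1 (2 ℕ.+ m)) (two·nar-1 (1 ℕ.+ m)) (two·nar-1 m) ⟩
    - (+ 4 + + m) * (+ (3 ℕ.+ m) * + (2 ℕ.+ m)) + (+ 5 + + 2 * + m) * (+ (2 ℕ.+ m) * + (1 ℕ.+ m))
      + - (+ 1 + + m) * (+ (1 ℕ.+ m) * + m) + (+ 14 + + 8 * + m)
      ≡⟨ col1-identity (+ m) ⟩
    + 0 ∎)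
    where
    open PE.≡-Reasoning
    x2 x1 x0 : ℕ
    x2 = nar (2 ℕ.+ m) 1
    x1 = nar (1 ℕ.+ m) 1
    x0 = nar m 1
    cong₃ : ∀ (f : ℤ → ℤ → ℤ → ℤ) {p p' q q' r r'} → p ≡ p' → q ≡ q' → r ≡ r' → f p q r ≡ f p' q' r'
    cong₃ f refl refl refl = refl

  narSeries-solves : narOp′ narSeries ≐ narRhs′
  narSeries-solves zero k = trans (narOp′-agree 0 (agree-weaken (agree-weaken narSeries-agrees-low)) k) (narSeriesLow-row0 k)
  narSeries-solves (suc zero) k = trans (narOp′-agree 1 (agree-weaken narSeries-agrees-low) k) (narSeriesLow-row1 k)
  narSeries-solves (suc (suc zero)) k = trans (narOp′-agree 2 narSeries-agrees-low k) (narSeriesLow-row2 k)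
  narSeries-solves (suc (suc (suc m))) zero = narSeries-solves-col0 m
  narSeries-solves (suc (suc (suc m))) (suc zero) = narSeries-solves-col1 m
  narSeries-solves (suc (suc (suc m))) (suc (suc j)) = narSeries-solves-interior m j

  quadratic⇒narSeries : ∀ R → quadratic R ≐ zeroS → R ≐ narSeries
  quadratic⇒narSeries R QR n k = ℤP.i-j≡0⇒i≡j (R n k) (narSeries n k) (narOp′-unique (R ⊕ ⊝ narSeries) homogeneous n k)
    where
    homogeneous : narOp′ (R ⊕ ⊝ narSeries) ≐ zeroS
    homogeneous = begin
      narOp′ (R ⊕ ⊝ narSeries)     ≈⟨ ≐-sym (narOp≐narOp′ (R ⊕ ⊝ narSeries)) ⟩
      narOp (R ⊕ ⊝ narSeries)      ≈⟨ narOp-linear R narSeries ⟩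
      narOp R ⊕ ⊝ narOp narSeries  ≈⟨ ⊕c (quadratic⇒narOp R QR) (⊝c (≐-trans (narOp≐narOp′ narSeries) (≐-trans narSeries-solves (≐-sym narRhs≐narRhs′)))) ⟩
      narRhs ⊕ ⊝ narRhs            ≈⟨ solve 1 (λ a → a :- a := con (+ 0)) ≐-refl narRhs ⟩
      zeroS                        ∎
      where open ≐-Reasoning



open import Data.Integer using (+_)
open import Data.Product using (Σ; _×_)
open SeriesBasics using (noConst-⊛ˡ; noConst-X; tailX)
open InverseBinomial using (invBinom-g≐h)
open QuadraticEquation using (closedForm; closedForm-quadratic; quadratic⇒solves; solves⇒quadratic; quadratic-unique)
open NarayanaNumbers using (nar-unfold)
open NarayanaSolution using (quadratic⇒narSeries; narSigned-vanish)

mainTheorem3 : (invBinom gS ≐ hS)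
    × Σ Ser (λ u → (∀ k → u 0 k ≡ + 0) × (u ⊛ (hS ∘S u) ≐ X))
    × ((u : Ser) → (∀ k → u 0 k ≡ + 0) → (u ⊛ (hS ∘S u) ≐ X) →
        let R : Ser
            R = λ n k → u (suc n) k
        in (R ≐ inv1+ (⊝ ((Rv ⊕ oneS) ⊛ X))
                  ⊛ (cS ∘S (⊝ (Rv ⊛ X) ⊛ inv1+ (⊝ ((Rv ⊕ oneS) ⊛ X)) ⊛ inv1+ (⊝ ((Rv ⊕ oneS) ⊛ X)))))
           × (R 0 0 ≡ + 1)
           × (∀ k → R 0 (suc k) ≡ + 0)
           × (∀ n k → k < suc n → R (suc n) k ≡ signedNarayana (suc n) k)
           × (∀ n k → suc n ≤ k → R (suc n) k ≡ + 0))
mainTheorem3 =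
    invBinom-g≐h
  , (X ⊛ closedForm , noConst-⊛ˡ X closedForm noConst-X , quadratic⇒solves closedForm closedForm-quadratic)
  , λ u z hu →
      let R-root = solves⇒quadratic u z hu
          R≐N    = quadratic⇒narSeries (tailX u) R-root
      in quadratic-unique (tailX u) closedForm R-root closedForm-quadratic
       , R≐N 0 0
       , (λ k → R≐N 0 (suc k))
       , (λ n k _ → PE.trans (R≐N (suc n) k) (PE.cong (λ t → sign k (+ t)) (nar-unfold n k)))
       , (λ n k n<k → PE.trans (R≐N (suc n) k) (narSigned-vanish n k n<k))
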